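{- Let $q\in\mathbb{N}$, $r\in\{1,\dots,q-1\}$ and $\varepsilon,\xi\in(0,1]$. Then there exists $n_0$ such that for all $n\ge n_0$ the following holds. Suppose that $G$ is an $(\varepsilon,\xi,q,r)$-supercomplex on $n$ vertices and $Y_{used}$ is a $q$-graph on $V(G)$ with $\Delta_r(Y_{used})\le\varepsilon n^{q-r}$. Then $G-Y_{used}$ is a $(2^{r+2}\varepsilon,\ \xi-2^{2r+1}\varepsilon,\ q,r)$-supercomplex.
   Context: For a $q$-graph $Y$ and a set $S$ with $|S|\le q$, $Y(S)$ is the set of $(q-|S|)$-sets $f$ with $S\cup f\in Y$; $\Delta_r(Y)$ is the maximum of $|Y(S)|$ over $r$-subsets $S$ of the vertex set. A complex is a hypergraph $G$ closed under taking subsets; $G$ is empty if $\emptyset\notin G$; $G^{(i)}$ is the $i$-graph of edges of size $i$. For $e\subseteq V(G)$, $G(e)$ is the complex on $V(G)\setminus e$ of all $f$ with $e\cup f\in G$; for $e\in G^{(r)}$, $G^{(q)}(e)$ is the set of $(q-r)$-sets $f$ with $e\cup f\in G$. Intersections of complexes are on the intersection of vertex sets. For a $q$-graph $Y$ on $V(G)$, $G[Y]$ is the complex of all $e\in G$ all of whose $q$-subsets lie in $Y$, and $G-Y:=G[G^{(q)}\setminus Y]$. $a=b\pm c$ means $b-c\le a\le b+c$. For a complex $G$ on $n$ vertices, $q\in\mathbb{N}$, $r\in\{0,\dots,q-1\}$: $(\varepsilon,d,q,r)$-regular: $|G^{(q)}(e)|=(d\pm\varepsilon)n^{q-r}$ for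 all $e\in G^{(r)}$; $(\xi,q,r)$-dense: $|G^{(q)}(e)|\ge\xi n^{q-r}$ for all $e\in G^{(r)}$; $(\xi,q,r)$-extendable: $G^{(r)}$ empty or some $X\subseteq V(G)$ with $|X|\ge\xi n$ is such that every $r$-subset $e$ of $X$ has at least $\xi n^{q-r}$ $(q-r)$-sets $Q\subseteq V(G)\setminus e$ with $\binom{Q\cup e}{r}\setminus\{e\}\subseteq G^{(r)}$. Full $(\varepsilon,\xi,q,r)$-complex: $(\varepsilon,d,q,r)$-regular for some $d\ge\xi$, $(\xi,q+r,r)$-dense, $(\xi,q,r)$-extendable. $(\varepsilon,\xi,q,r)$-complex: $G[Y]$ is a full $(\varepsilon,\xi,q,r)$-complex for some $q$-graph $Y$ on $V(G)$. $(\varepsilon,\xi,q,r)$-supercomplex: for all $i\in\{0,\dots,r\}$ and $F\subseteq G^{(i)}$ with $1\le|F|\le 2^i$, $\bigcap_{f\in F}G(f)$ is an $(\varepsilon,\xi,q-i,r-i)$-complex.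
   Formalization: The parameters $\varepsilon,\xi\in(0,1]$ and the density d in the definition of a full complex range over the rationals instead of the reals. -}

module Defs where

open import Data.Bool using (Bool; true; false; _∧_; _∨_; not; if_then_else_)
open import Data.Nat as ℕ using (ℕ; zero; suc; _∸_; _^_; _≡ᵇ_)
open import Data.Integer as ℤ using (ℤ)
open import Data.Rational as ℚ using (ℚ; _≤_; _*_)
open import Data.List using (List; []; _∷_; map; _++_; length; filterᵇ; foldr)
open import Data.Vec using (Vec; []; _∷_)
open import Data.Fin.Subset using (Subset; inside; outside; _∪_; _∩_; _─_; ⊤; ∣_∣; _⊆_)
open import Data.Product using (Σ; _×_; ∃)
open import Data.Sum using (_⊎_)
open import Relation.Binary.PropositionalEquality using (_≡_; _≢_)
open import Data.List.Membership.Propositional using (_∈_)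
open import Data.List.Relation.Unary.Unique.Propositional using (Unique)

allSubsets : (n : ℕ) → List (Subset n)
allSubsets zero    = [] ∷ []
allSubsets (suc n) = map (inside ∷_) (allSubsets n) ++ map (outside ∷_) (allSubsets n)

_⊆ᵇ_ : ∀ {n} → Subset n → Subset n → Bool
[] ⊆ᵇ [] = true
(x ∷ xs) ⊆ᵇ (y ∷ ys) = (not x ∨ y) ∧ (xs ⊆ᵇ ys)

_=ᵇ_ : ∀ {n} → Subset n → Subset n → Bool
[] =ᵇ [] = true
(x ∷ xs) =ᵇ (y ∷ ys) = ((x ∧ y) ∨ (not x ∧ not y)) ∧ (xs =ᵇ ys)

allᵇ : ∀ {A : Set} → (A → Bool) → List A → Bool
allᵇ P [] = true
allᵇ P (x ∷ xs) = P x ∧ allᵇ P xs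

count : ∀ {n} → (Subset n → Bool) → ℕ
count {n} P = length (filterᵇ P (allSubsets n))

toℚ : ℕ → ℚ
toℚ k = (ℤ.+ k) ℚ./ 1

-- Hypergraphs and complexes on a vertex set V ⊆ Fin N.
-- Edges are given by a boolean predicate on subsets of Fin N.

Hypergraph : ℕ → Set
Hypergraph N = Subset N → Bool

record Cx (N : ℕ) : Set where
  field
    V : Subset N
    E : Hypergraph N
open Cx public

∣V∣ : ∀ {N} → Cx N → ℕ
∣V∣ G = ∣ V G ∣

IsComplex : ∀ {N} → Cx N → Set
IsComplex G = (∀ e → E G e ≡ true → e ⊆ V G)
            × (∀ e f → f ⊆ e → E G e ≡ true → E G f ≡ true)

IsGraphOn : ∀ {N} → ℕ → Subset N → Hypergraph N → Set
IsGraphOn q V Y = ∀ s → Y s ≡ true → (∣ s ∣ ≡ q) × (s ⊆ V)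

∣link∣ : ∀ {N} → ℕ → Hypergraph N → Subset N → ℕ
∣link∣ q Y S = count (λ f → (∣ f ∣ ≡ᵇ (q ∸ ∣ S ∣)) ∧ Y (S ∪ f))

Δ≤ : ∀ {N} → ℕ → ℕ → Subset N → Hypergraph N → ℚ → Set
Δ≤ q r V Y c = ∀ S → ∣ S ∣ ≡ r → S ⊆ V → toℚ (∣link∣ q Y S) ≤ c

∣Gq∣ : ∀ {N} → Cx N → ℕ → Subset N → ℕ
∣Gq∣ G q e = count (λ f → (∣ f ∣ ≡ᵇ (q ∸ ∣ e ∣)) ∧ (f ⊆ᵇ V G)
                        ∧ (∣ e ∪ f ∣ ≡ᵇ q) ∧ E G (e ∪ f))

InLayer : ∀ {N} → Cx N → ℕ → Subset N → Set
InLayer G r e = (∣ e ∣ ≡ r) × (E G e ≡ true)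

IsRegular : ∀ {N} → ℚ → ℚ → ℕ → ℕ → Cx N → Set
IsRegular ε d q r G =
  ∀ e → InLayer G r e →
    ((d ℚ.- ε) * toℚ (∣V∣ G ^ (q ∸ r)) ≤ toℚ (∣Gq∣ G q e))
    × (toℚ (∣Gq∣ G q e) ≤ (d ℚ.+ ε) * toℚ (∣V∣ G ^ (q ∸ r)))

IsDense : ∀ {N} → ℚ → ℕ → ℕ → Cx N → Set
IsDense ξ q r G =
  ∀ e → InLayer G r e → ξ * toℚ (∣V∣ G ^ (q ∸ r)) ≤ toℚ (∣Gq∣ G q e)

-- binom(Q ∪ e, r) ∖ {e} ⊆ G^{(r)}
extBool : ∀ {N} → Cx N → ℕ → Subset N → Subset N → Bool
extBool {N} G r e Q =
  allᵇ (λ s → not ((∣ s ∣ ≡ᵇ r) ∧ (s ⊆ᵇ (Q ∪ e)) ∧ not (s =ᵇ e)) ∨ E G s)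
      (allSubsets N)

∣ext∣ : ∀ {N} → Cx N → ℕ → ℕ → Subset N → ℕ
∣ext∣ G q r e = count (λ Q → (∣ Q ∣ ≡ᵇ (q ∸ r)) ∧ (Q ⊆ᵇ (V G ─ e)) ∧ extBool G r e Q)

IsExtendable : ∀ {N} → ℚ → ℕ → ℕ → Cx N → Set
IsExtendable ξ q r G =
  (∀ e → ¬InLayer e)
  ⊎ Σ _ (λ X → (X ⊆ V G) × (ξ * toℚ (∣V∣ G) ≤ toℚ ∣ X ∣)
        × (∀ e → ∣ e ∣ ≡ r → e ⊆ X →
             ξ * toℚ (∣V∣ G ^ (q ∸ r)) ≤ toℚ (∣ext∣ G q r e)))
  where
    ¬InLayer : _ → Set
    ¬InLayer e = InLayer G r e → Data.Empty.⊥
      where import Data.Empty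

IsFullComplex : ∀ {N} → ℚ → ℚ → ℕ → ℕ → Cx N → Set
IsFullComplex ε ξ q r G =
  Σ ℚ (λ d → (ξ ≤ d) × IsRegular ε d q r G)
  × IsDense ξ (q ℕ.+ r) r G
  × IsExtendable ξ q r G

-- G[Y]: all edges of G all of whose q-subsets lie in Y (same vertex set)
induced : ∀ {N} → ℕ → Cx N → Hypergraph N → Cx N
induced {N} q G Y = record
  { V = V G
  ; E = λ e → E G e ∧ allᵇ (λ s → not ((s ⊆ᵇ e) ∧ (∣ s ∣ ≡ᵇ q)) ∨ Y s) (allSubsets N)
  }

remove : ∀ {N} → ℕ → Cx N → Hypergraph N → Cx N
remove q G Y = induced q G (λ s → E G s ∧ (∣ s ∣ ≡ᵇ q) ∧ not (Y s))

IsEpsComplex : ∀ {N} → ℚ → ℚ → ℕ → ℕ → Cx N → Set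
IsEpsComplex ε ξ q r G =
  Σ (Hypergraph _) (λ Y → IsGraphOn q (V G) Y × IsFullComplex ε ξ q r (induced q G Y))

linkAll : ∀ {N} → Cx N → List (Subset N) → Cx N
linkAll G F = record
  { V = W
  ; E = λ g → (g ⊆ᵇ W) ∧ allᵇ (λ f → E G (f ∪ g)) F
  }
  where W = foldr (λ f U → U ─ f) (V G) F

IsSupercomplex : ∀ {N} → ℚ → ℚ → ℕ → ℕ → Cx N → Set
IsSupercomplex ε ξ q r G =
  IsComplex G
  × (∀ i → i ℕ.≤ r → (F : List (Subset _)) → Unique F →
       1 ℕ.≤ length F → length F ℕ.≤ 2 ^ i →
       (∀ f → f ∈ F → InLayer G i f) →
       IsEpsComplex ε ξ (q ∸ i) (r ∸ i) (linkAll G F))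

-- A link complex H = G(F)[Y] of G loses, in G - Y_used, only edges g for which some f ∪ g
-- (f ∈ F) contains an edge of Y_used. Given an (r-i)-set e, the extensions h of e destroyed this
-- way are counted through the trace t = s ∩ (f ∪ e) of such an edge s: there are at most 2^r
-- traces, and for each the codegree bound Δ_r(Y_used) ≤ εn^{q-r} leaves at most εn^{q-i} choices
-- of h; if h only has size q - r, then s = f ∪ e ∪ h, so at most εn^{q-r} choices remain. Summing
-- over the at most 2^r sets f, and using that H has n - O(1) vertices, so that n^p ≤ 2|V(H)|^p
-- for large n, the degrees of H drop by at most 2^{r+1}ε|V(H)|^{q-r} in the regularity layer and
-- by 2^{2r+1}ε|V(H)|^{q-i} in the density layer. For an (r-i)-set e each f ∪ e has at most r < q
-- elements and so contains no edge of Y_used: the (r-i)-layer, and with it extendability, is untouched.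

module Submission where

open import Defs
open import Data.Nat using (ℕ; _≤_; _<_; _^_; _∸_; _+_; _*_)
open import Data.Rational using (ℚ; 0ℚ; 1ℚ; _-_) renaming (_*_ to _*ℚ_; _<_ to _<ℚ_; _≤_ to _≤ℚ_)
open import Data.Fin.Subset using (⊤)
open import Data.Product using (Σ; _×_)
open import Relation.Binary.PropositionalEquality using (_≡_)
open import Data.Bool using (Bool; true; false; _∧_; _∨_; not; T)
import Data.Bool.Properties as BoolP
open import Data.Nat as ℕ using (zero; suc; _≡ᵇ_; z≤n; s≤s)
import Data.Nat.Properties as ℕP
open import Data.Nat.Solver using (module +-*-Solver)
import Data.Nat.Coprimality as Coprime
open import Data.Integer as ℤ using (+_)
import Data.Integer.Properties as ℤP
open import Data.Rational as ℚ using (mkℚ; *≤*)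
import Data.Rational.Properties as ℚP
import Data.Rational.Solver as ℚSolver
open import Data.List using (List; []; _∷_; map; _++_; length; filterᵇ; foldr)
import Data.List.Properties as ListP
open import Data.List.Membership.Propositional using (_∈_)
open import Data.List.Relation.Unary.Any using (here; there)
open import Data.List.Relation.Unary.Unique.Propositional using (Unique)
open import Data.Vec.Base using ([]; _∷_)
import Data.Vec.Base as Vec
open import Data.Fin.Subset using (Subset; inside; outside; _∪_; _∩_; _─_; ∣_∣; _⊆_)
import Data.Fin.Subset.Properties as SubsetP
open import Data.Product using (_,_; proj₁; proj₂)
open import Data.Sum using (_⊎_; inj₁; inj₂)
open import Relation.Binary.PropositionalEquality
  using (refl; sym; trans; cong; cong₂; subst; subst₂; _≢_; module ≡-Reasoning)
open import Relation.Nullary using (¬_; Dec; yes; no; contradiction)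
open import Relation.Nullary.Decidable.Core using (T?)

toℚ≡mkℚ : ∀ k → toℚ k ≡ mkℚ (+ k) 0 (Coprime.sym (Coprime.1-coprimeTo k))
toℚ≡mkℚ k = ℚP.normalize-coprime (Coprime.sym (Coprime.1-coprimeTo k))

toℚ-+ : ∀ a b → toℚ (a + b) ≡ toℚ a ℚ.+ toℚ b
toℚ-+ a b = trans (ℚP./-cong {+ (a + b)} {1} {(+ a ℤ.* + 1) ℤ.+ (+ b ℤ.* + 1)} {1} numerators refl)
                  (sym (cong₂ ℚ._+_ (toℚ≡mkℚ a) (toℚ≡mkℚ b)))
  where
  numerators : + (a + b) ≡ (+ a ℤ.* + 1) ℤ.+ (+ b ℤ.* + 1)
  numerators = trans (ℤP.pos-+ a b) (sym (cong₂ ℤ._+_ (ℤP.*-identityʳ (+ a)) (ℤP.*-identityʳ (+ b))))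

toℚ-* : ∀ a b → toℚ (a * b) ≡ toℚ a ℚ.* toℚ b
toℚ-* a b = trans (ℚP./-cong {+ (a * b)} {1} {+ a ℤ.* + b} {1} (ℤP.pos-* a b) refl)
                  (sym (cong₂ ℚ._*_ (toℚ≡mkℚ a) (toℚ≡mkℚ b)))

toℚ-mono-≤ : ∀ {a b} → a ℕ.≤ b → toℚ a ℚ.≤ toℚ b
toℚ-mono-≤ {a} {b} a≤b rewrite toℚ≡mkℚ a | toℚ≡mkℚ b =
  *≤* (subst₂ ℤ._≤_ (sym (ℤP.*-identityʳ (+ a))) (sym (ℤP.*-identityʳ (+ b))) (ℤ.+≤+ a≤b))

-- toℚ normalises through a gcd computed by well-founded recursion, so Agda should never be asked to
-- unfold it: numerals are converted once, here, and only rewritten with elsewhere.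
toℚ-0 : toℚ 0 ≡ 0ℚ
toℚ-0 = refl

toℚ-1 : toℚ 1 ≡ 1ℚ
toℚ-1 = refl

0≤toℚ : ∀ k → 0ℚ ℚ.≤ toℚ k
0≤toℚ k = toℚ-mono-≤ {0} {k} z≤n

0≤* : ∀ {a b} → 0ℚ ℚ.≤ a → 0ℚ ℚ.≤ b → 0ℚ ℚ.≤ a ℚ.* b
0≤* {a} {b} 0≤a 0≤b =
  ℚP.nonNegative⁻¹ _ {{ℚP.nonNeg*nonNeg⇒nonNeg a {{ℚ.nonNegative 0≤a}} b {{ℚ.nonNegative 0≤b}}}}

*-monoʳ-≤-0≤ : ∀ {a b} c → 0ℚ ℚ.≤ c → a ℚ.≤ b → a ℚ.* c ℚ.≤ b ℚ.* c
*-monoʳ-≤-0≤ c 0≤c = ℚP.*-monoʳ-≤-nonNeg c {{ℚ.nonNegative 0≤c}}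

*-monoˡ-≤-0≤ : ∀ {a b} c → 0ℚ ℚ.≤ c → a ℚ.≤ b → c ℚ.* a ℚ.≤ c ℚ.* b
*-monoˡ-≤-0≤ c 0≤c = ℚP.*-monoˡ-≤-nonNeg c {{ℚ.nonNegative 0≤c}}

toℚ-≤-+ : ∀ {a} b c → a ℕ.≤ b + c → toℚ a ℚ.≤ toℚ b ℚ.+ toℚ c
toℚ-≤-+ b c a≤b+c = ℚP.≤-trans (toℚ-mono-≤ a≤b+c) (ℚP.≤-reflexive (toℚ-+ b c))

p≤toℚm*p : ∀ {ε} M → 0ℚ ℚ.≤ ε → 1 ℕ.≤ M → ε ℚ.≤ toℚ M ℚ.* ε
p≤toℚm*p {ε} M 0≤ε 1≤M = begin
  ε              ≡⟨ sym (ℚP.*-identityˡ ε) ⟩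
  1ℚ ℚ.* ε       ≡⟨ cong (ℚ._* ε) (sym toℚ-1) ⟩
  toℚ 1 ℚ.* ε    ≤⟨ *-monoʳ-≤-0≤ ε 0≤ε (toℚ-mono-≤ 1≤M) ⟩
  toℚ M ℚ.* ε    ∎
  where open ℚP.≤-Reasoning

≤-minus-bounded : ∀ a c W {old new bad} → a ℚ.* W ℚ.≤ old → old ℚ.≤ new ℚ.+ bad → bad ℚ.≤ c ℚ.* W →
                  (a ℚ.- c) ℚ.* W ℚ.≤ new
≤-minus-bounded a c W {old} {new} {bad} aW≤old old≤new+bad bad≤cW = begin
  (a ℚ.- c) ℚ.* W                ≡⟨ solve 3 (λ a c W → (a :- c) :* W := a :* W :- c :* W) refl a c W ⟩
  a ℚ.* W ℚ.- c ℚ.* W            ≤⟨ ℚP.+-monoˡ-≤ (ℚ.- (c ℚ.* W)) (ℚP.≤-trans aW≤old old≤new+bad) ⟩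
  new ℚ.+ bad ℚ.- c ℚ.* W        ≤⟨ ℚP.+-monoˡ-≤ (ℚ.- (c ℚ.* W)) (ℚP.+-monoʳ-≤ new bad≤cW) ⟩
  new ℚ.+ c ℚ.* W ℚ.- c ℚ.* W    ≡⟨ solve 2 (λ new cW → new :+ cW :- cW := new) refl new (c ℚ.* W) ⟩
  new                            ∎
  where
  open ℚP.≤-Reasoning
  open ℚSolver.+-*-Solver

toℚ-*-scale : ∀ ε a a' b b' → 0ℚ ℚ.≤ ε → a ℕ.≤ a' → b ℕ.≤ 2 * b' →
              toℚ a ℚ.* (ε ℚ.* toℚ b) ℚ.≤ toℚ (a' * 2) ℚ.* (ε ℚ.* toℚ b')
toℚ-*-scale ε a a' b b' 0≤ε a≤a' b≤2b' = begin
  toℚ a ℚ.* (ε ℚ.* toℚ b)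
    ≤⟨ *-monoʳ-≤-0≤ (ε ℚ.* toℚ b) (0≤* 0≤ε (0≤toℚ b)) (toℚ-mono-≤ a≤a') ⟩
  toℚ a' ℚ.* (ε ℚ.* toℚ b)
    ≤⟨ *-monoˡ-≤-0≤ (toℚ a') (0≤toℚ a') (*-monoˡ-≤-0≤ ε 0≤ε (toℚ-mono-≤ b≤2b')) ⟩
  toℚ a' ℚ.* (ε ℚ.* toℚ (2 * b'))
    ≡⟨ cong (λ x → toℚ a' ℚ.* (ε ℚ.* x)) (toℚ-* 2 b') ⟩
  toℚ a' ℚ.* (ε ℚ.* (toℚ 2 ℚ.* toℚ b'))
    ≡⟨ solve 4 (λ a e t b → a :* (e :* (t :* b)) := (a :* t) :* (e :* b)) refl (toℚ a') ε (toℚ 2) (toℚ b') ⟩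
  (toℚ a' ℚ.* toℚ 2) ℚ.* (ε ℚ.* toℚ b')
    ≡⟨ cong (ℚ._* (ε ℚ.* toℚ b')) (sym (toℚ-* a' 2)) ⟩
  toℚ (a' * 2) ℚ.* (ε ℚ.* toℚ b') ∎
  where
  open ℚP.≤-Reasoning
  open ℚSolver.+-*-Solver

[m∸n]+[n∸o]≡m∸o : ∀ {m n o} → o ℕ.≤ n → n ℕ.≤ m → (m ∸ n) + (n ∸ o) ≡ m ∸ o
[m∸n]+[n∸o]≡m∸o {m} {n} {o} o≤n n≤m =
  trans (sym (ℕP.+-∸-assoc (m ∸ n) o≤n)) (cong (_∸ o) (ℕP.m∸n+n≡m n≤m))

[m∸o]∸[n∸o]≡m∸n : ∀ {m n o} → o ℕ.≤ n → n ℕ.≤ m → (m ∸ o) ∸ (n ∸ o) ≡ m ∸ n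
[m∸o]∸[n∸o]≡m∸n {m} {n} {o} o≤n n≤m =
  trans (cong (_∸ (n ∸ o)) (sym ([m∸n]+[n∸o]≡m∸o o≤n n≤m))) (ℕP.m+n∸n≡m (m ∸ n) (n ∸ o))

[m∸o]∸[m∸n]≡n∸o : ∀ {m n o} → o ℕ.≤ n → n ℕ.≤ m → (m ∸ o) ∸ (m ∸ n) ≡ n ∸ o
[m∸o]∸[m∸n]≡n∸o {m} {n} {o} o≤n n≤m =
  trans (cong (_∸ (m ∸ n)) (sym ([m∸n]+[n∸o]≡m∸o o≤n n≤m))) (ℕP.m+n∸m≡n (m ∸ n) (n ∸ o))

^[r∸k]*^[q∸r]*^[k∸i]≡^[q∸i] : ∀ m {i k r q} → i ℕ.≤ k → k ℕ.≤ r → r ℕ.≤ q →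
                              m ^ (r ∸ k) * m ^ (q ∸ r) * m ^ (k ∸ i) ≡ m ^ (q ∸ i)
^[r∸k]*^[q∸r]*^[k∸i]≡^[q∸i] m {i} {k} {r} {q} i≤k k≤r r≤q = begin
  m ^ (r ∸ k) * m ^ (q ∸ r) * m ^ (k ∸ i)     ≡⟨ cong (_* m ^ (k ∸ i)) (ℕP.*-comm (m ^ (r ∸ k)) (m ^ (q ∸ r))) ⟩
  m ^ (q ∸ r) * m ^ (r ∸ k) * m ^ (k ∸ i)     ≡⟨ cong (_* m ^ (k ∸ i)) (sym (ℕP.^-distribˡ-+-* m (q ∸ r) (r ∸ k))) ⟩
  m ^ ((q ∸ r) + (r ∸ k)) * m ^ (k ∸ i)       ≡⟨ cong (λ x → m ^ x * m ^ (k ∸ i)) ([m∸n]+[n∸o]≡m∸o k≤r r≤q) ⟩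
  m ^ (q ∸ k) * m ^ (k ∸ i)                   ≡⟨ sym (ℕP.^-distribˡ-+-* m (q ∸ k) (k ∸ i)) ⟩
  m ^ ((q ∸ k) + (k ∸ i))                     ≡⟨ cong (m ^_) ([m∸n]+[n∸o]≡m∸o i≤k (ℕP.≤-trans k≤r r≤q)) ⟩
  m ^ (q ∸ i)                                 ∎
  where open ≡-Reasoning

^-suc-step : ∀ n k → n ^ k + n ^ suc k ℕ.≤ suc n ^ suc k
^-suc-step n k = begin
  n ^ k + n * n ^ k            ≤⟨ ℕP.+-mono-≤ n^k≤ (ℕP.*-monoʳ-≤ n n^k≤) ⟩
  suc n ^ k + n * suc n ^ k    ∎
  where
  open ℕP.≤-Reasoning
  n^k≤ : n ^ k ℕ.≤ suc n ^ k
  n^k≤ = ℕP.^-monoˡ-≤ k (ℕP.n≤1+n n)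

1+2^r*2≤2^[r+2] : ∀ r → suc (2 ^ r * 2) ℕ.≤ 2 ^ (r + 2)
1+2^r*2≤2^[r+2] r = begin
  suc (2 ^ r * 2)           ≤⟨ ℕP.+-monoˡ-≤ (2 ^ r * 2) (ℕP.≤-trans (ℕP.m^n>0 2 r) (ℕP.m≤m*n (2 ^ r) 2)) ⟩
  2 ^ r * 2 + 2 ^ r * 2     ≡⟨ solve 1 (λ x → x :* con 2 :+ x :* con 2 := x :* con 4) refl (2 ^ r) ⟩
  2 ^ r * 2 ^ 2             ≡⟨ sym (ℕP.^-distribˡ-+-* 2 r 2) ⟩
  2 ^ (r + 2)               ∎
  where
  open ℕP.≤-Reasoning
  open +-*-Solver

2^r*2^r*2≡2^[2r+1] : ∀ r → 2 ^ r * 2 ^ r * 2 ≡ 2 ^ (2 * r + 1)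
2^r*2^r*2≡2^[2r+1] r = begin
  2 ^ r * 2 ^ r * 2     ≡⟨ cong (_* 2) (sym (ℕP.^-distribˡ-+-* 2 r r)) ⟩
  2 ^ (r + r) * 2 ^ 1   ≡⟨ sym (ℕP.^-distribˡ-+-* 2 (r + r) 1) ⟩
  2 ^ (r + r + 1)       ≡⟨ cong (λ k → 2 ^ (r + k + 1)) (sym (ℕP.+-identityʳ r)) ⟩
  2 ^ (2 * r + 1)       ∎
  where open ≡-Reasoning

[m+c]^p*m≤m^[1+p]+p*c*[m+c]^p : ∀ m c p → (m + c) ^ p * m ℕ.≤ m ^ suc p + p * c * (m + c) ^ p
[m+c]^p*m≤m^[1+p]+p*c*[m+c]^p m c zero = ℕP.≤-reflexive (solve 1 (λ m → con 1 :* m := m :* con 1 :+ con 0) refl m)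
  where open +-*-Solver
[m+c]^p*m≤m^[1+p]+p*c*[m+c]^p m c (suc p) = begin
  (m + c) ^ suc p * m                          ≡⟨ ℕP.*-assoc (m + c) ((m + c) ^ p) m ⟩
  (m + c) * ((m + c) ^ p * m)                  ≤⟨ ℕP.*-monoʳ-≤ (m + c) ([m+c]^p*m≤m^[1+p]+p*c*[m+c]^p m c p) ⟩
  (m + c) * (A + p * c * B)                    ≡⟨ solve 5 (λ m c p A B → (m :+ c) :* (A :+ p :* c :* B)
                                                     := m :* A :+ c :* A :+ p :* c :* ((m :+ c) :* B)) refl m c p A B ⟩
  m * A + c * A + p * c * ((m + c) * B)        ≤⟨ ℕP.+-monoˡ-≤ (p * c * D) (ℕP.+-monoʳ-≤ (m * A)
                                                     (ℕP.*-monoʳ-≤ c (ℕP.^-monoˡ-≤ (suc p) (ℕP.m≤m+n m c)))) ⟩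
  m * A + c * D + p * c * D                    ≡⟨ solve 5 (λ m A c D p → m :* A :+ c :* D :+ p :* c :* D
                                                     := m :* A :+ (con 1 :+ p) :* c :* D) refl m A c D p ⟩
  m * A + suc p * c * D                        ∎
  where
  open ℕP.≤-Reasoning
  open +-*-Solver
  A = m ^ suc p
  B = (m + c) ^ p
  D = (m + c) ^ suc p

[m+c]^p≤2*m^p : ∀ m c p → 1 ℕ.≤ m → 2 * p * c ℕ.≤ m → (m + c) ^ p ℕ.≤ 2 * m ^ p
[m+c]^p≤2*m^p (suc m) c p _ 2pc≤m = ℕP.*-cancelʳ-≤ X (2 * M ^ p) M X*M≤2M^p*M
  where
  open ℕP.≤-Reasoning
  open +-*-Solver
  M = suc m
  X = (M + c) ^ p
  2XM≤2M^[1+p]+XM : X * M + X * M ℕ.≤ 2 * M ^ suc p + X * M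
  2XM≤2M^[1+p]+XM = begin
    X * M + X * M                      ≡⟨ solve 1 (λ y → y :+ y := con 2 :* y) refl (X * M) ⟩
    2 * (X * M)                        ≤⟨ ℕP.*-monoʳ-≤ 2 ([m+c]^p*m≤m^[1+p]+p*c*[m+c]^p M c p) ⟩
    2 * (M ^ suc p + p * c * X)        ≡⟨ solve 4 (λ a p c X → con 2 :* (a :+ p :* c :* X)
                                                   := con 2 :* a :+ con 2 :* p :* c :* X) refl (M ^ suc p) p c X ⟩
    2 * M ^ suc p + 2 * p * c * X      ≤⟨ ℕP.+-monoʳ-≤ (2 * M ^ suc p) (ℕP.*-monoˡ-≤ X 2pc≤m) ⟩
    2 * M ^ suc p + M * X              ≡⟨ cong (λ k → 2 * M ^ suc p + k) (ℕP.*-comm M X) ⟩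
    2 * M ^ suc p + X * M              ∎
  X*M≤2M^p*M : X * M ℕ.≤ 2 * M ^ p * M
  X*M≤2M^p*M = ℕP.≤-trans (ℕP.+-cancelʳ-≤ (X * M) (X * M) (2 * M ^ suc p) 2XM≤2M^[1+p]+XM)
                          (ℕP.≤-reflexive (solve 2 (λ M a → con 2 :* (M :* a) := con 2 :* a :* M) refl M (M ^ p)))

∧-elimˡ : ∀ {a b} → (a ∧ b) ≡ true → a ≡ true
∧-elimˡ {true} _ = refl

∧-elimʳ : ∀ {a b} → (a ∧ b) ≡ true → b ≡ true
∧-elimʳ {true} b≡true = b≡true

∧-intro : ∀ {a b} → a ≡ true → b ≡ true → (a ∧ b) ≡ true
∧-intro refl refl = refl

∧-falseʳ : ∀ {a b} → (a ∧ b) ≡ false → a ≡ true → b ≡ false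
∧-falseʳ e refl = e

∧-falseˡ : ∀ {a b} → (a ∧ b) ≡ false → b ≡ true → a ≡ false
∧-falseˡ {false} _ _    = refl
∧-falseˡ {true}  e refl = e

∧³-last : ∀ a b c {x} → (a ∧ b ∧ c ∧ x) ≡ true → x ≡ true
∧³-last true true true x = x

∧³-replace : ∀ a b c {x y} → (a ∧ b ∧ c ∧ x) ≡ true → (x ≡ true → y ≡ true) → (a ∧ b ∧ c ∧ y) ≡ true
∧³-replace true true true x x⇒y = x⇒y x

≡ᵇ⇒≡ : ∀ m n → (m ≡ᵇ n) ≡ true → m ≡ n
≡ᵇ⇒≡ m n e = ℕP.≡ᵇ⇒≡ m n (subst T (sym e) _)

≡⇒≡ᵇ : ∀ m n → m ≡ n → (m ≡ᵇ n) ≡ true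
≡⇒≡ᵇ zero    zero    _ = refl
≡⇒≡ᵇ (suc m) (suc n) e = ≡⇒≡ᵇ m n (ℕP.suc-injective e)

≢⇒≡ᵇ-false : ∀ m n → m ≢ n → (m ≡ᵇ n) ≡ false
≢⇒≡ᵇ-false m n m≢n with m ≡ᵇ n in eq
... | false = refl
... | true  = contradiction (≡ᵇ⇒≡ m n eq) m≢n

¬true⇒false : ∀ {b} → ¬ (b ≡ true) → b ≡ false
¬true⇒false {false} _ = refl
¬true⇒false {true} ¬b = contradiction refl ¬b

allᵇ-elim : ∀ {A : Set} (P : A → Bool) xs x → allᵇ P xs ≡ true → x ∈ xs → P x ≡ true
allᵇ-elim P (y ∷ xs) x all (here refl)  = ∧-elimˡ all
allᵇ-elim P (y ∷ xs) x all (there x∈xs) = allᵇ-elim P xs x (∧-elimʳ {P y} all) x∈xs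

allᵇ-intro : ∀ {A : Set} (P : A → Bool) xs → (∀ x → x ∈ xs → P x ≡ true) → allᵇ P xs ≡ true
allᵇ-intro P []       _   = refl
allᵇ-intro P (y ∷ xs) all = ∧-intro (all y (here refl)) (allᵇ-intro P xs (λ x x∈xs → all x (there x∈xs)))

allᵇ-false : ∀ {A : Set} (P : A → Bool) xs → allᵇ P xs ≡ false → Σ A (λ x → (x ∈ xs) × (P x ≡ false))
allᵇ-false P (y ∷ xs) e with P y in Py
... | false = y , here refl , Py
... | true with x , x∈xs , Px ← allᵇ-false P xs e = x , there x∈xs , Px

allᵇ-cong : ∀ {A : Set} (P Q : A → Bool) xs → (∀ x → x ∈ xs → P x ≡ Q x) → allᵇ P xs ≡ allᵇ Q xs
allᵇ-cong P Q []       _   = refl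
allᵇ-cong P Q (y ∷ xs) P≡Q = cong₂ _∧_ (P≡Q y (here refl)) (allᵇ-cong P Q xs (λ x x∈xs → P≡Q x (there x∈xs)))

anyᵇ : ∀ {A : Set} → (A → Bool) → List A → Bool
anyᵇ P []       = false
anyᵇ P (x ∷ xs) = P x ∨ anyᵇ P xs

anyᵇ-intro : ∀ {A : Set} (P : A → Bool) xs x → x ∈ xs → P x ≡ true → anyᵇ P xs ≡ true
anyᵇ-intro P (y ∷ xs) x (here refl) Px rewrite Px = refl
anyᵇ-intro P (y ∷ xs) x (there x∈xs) Px rewrite anyᵇ-intro P xs x x∈xs Px = BoolP.∨-zeroʳ (P y)

anySubset : ∀ {n} → (Subset n → Bool) → Bool
anySubset {zero}  P = P []
anySubset {suc n} P = anySubset (λ x → P (true ∷ x)) ∨ anySubset (λ x → P (false ∷ x))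

anySubset-intro : ∀ {n} (P : Subset n → Bool) s → P s ≡ true → anySubset P ≡ true
anySubset-intro P []          Ps = Ps
anySubset-intro P (true ∷ s)  Ps rewrite anySubset-intro (λ x → P (true ∷ x)) s Ps = refl
anySubset-intro P (false ∷ s) Ps rewrite anySubset-intro (λ x → P (false ∷ x)) s Ps = BoolP.∨-zeroʳ _

anySubset-elim : ∀ {n} (P : Subset n → Bool) → anySubset P ≡ true → Σ (Subset n) (λ s → P s ≡ true)
anySubset-elim {zero}  P e = [] , e
anySubset-elim {suc n} P e with anySubset (λ x → P (true ∷ x)) in e₁
... | true with s , Ps ← anySubset-elim (λ x → P (true ∷ x)) e₁ = true ∷ s , Ps
... | false with s , Ps ← anySubset-elim (λ x → P (false ∷ x)) e = false ∷ s , Ps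

⊆ᵇ⇒⊆ : ∀ {n} (d h : Subset n) → d ⊆ᵇ h ≡ true → d ⊆ h
⊆ᵇ⇒⊆ []          []          _ = SubsetP.⊆-refl
⊆ᵇ⇒⊆ (true ∷ d)  (true ∷ h)  e = SubsetP.in⊆in (⊆ᵇ⇒⊆ d h e)
⊆ᵇ⇒⊆ (false ∷ d) (_ ∷ h)     e = SubsetP.out⊆ (⊆ᵇ⇒⊆ d h e)

⊆⇒⊆ᵇ : ∀ {n} (d h : Subset n) → d ⊆ h → d ⊆ᵇ h ≡ true
⊆⇒⊆ᵇ []          []          _   = refl
⊆⇒⊆ᵇ (true ∷ d)  (true ∷ h)  d⊆h = ⊆⇒⊆ᵇ d h (SubsetP.drop-∷-⊆ d⊆h)
⊆⇒⊆ᵇ (true ∷ d)  (false ∷ h) d⊆h = contradiction (d⊆h Vec.here) λ ()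
⊆⇒⊆ᵇ (false ∷ d) (_ ∷ h)     d⊆h = ⊆⇒⊆ᵇ d h (SubsetP.drop-∷-⊆ d⊆h)

⊆ᵇ-trans : ∀ {n} (a b c : Subset n) → a ⊆ᵇ b ≡ true → b ⊆ᵇ c ≡ true → a ⊆ᵇ c ≡ true
⊆ᵇ-trans a b c a⊆b b⊆c = ⊆⇒⊆ᵇ a c (SubsetP.⊆-trans (⊆ᵇ⇒⊆ a b a⊆b) (⊆ᵇ⇒⊆ b c b⊆c))

⊆ᵇ⇒∣∣≤ : ∀ {n} (d h : Subset n) → d ⊆ᵇ h ≡ true → ∣ d ∣ ℕ.≤ ∣ h ∣
⊆ᵇ⇒∣∣≤ d h d⊆h = SubsetP.p⊆q⇒∣p∣≤∣q∣ (⊆ᵇ⇒⊆ d h d⊆h)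

p∩q⊆ᵇp : ∀ {n} (p q : Subset n) → (p ∩ q) ⊆ᵇ p ≡ true
p∩q⊆ᵇp p q = ⊆⇒⊆ᵇ (p ∩ q) p (SubsetP.p∩q⊆p p q)

p∩q⊆ᵇq : ∀ {n} (p q : Subset n) → (p ∩ q) ⊆ᵇ q ≡ true
p∩q⊆ᵇq p q = ⊆⇒⊆ᵇ (p ∩ q) q (SubsetP.p∩q⊆q p q)

=ᵇ-refl : ∀ {n} (s : Subset n) → s =ᵇ s ≡ true
=ᵇ-refl []          = refl
=ᵇ-refl (true ∷ s)  = =ᵇ-refl s
=ᵇ-refl (false ∷ s) = =ᵇ-refl s

=ᵇ⇒≡ : ∀ {n} (s t : Subset n) → s =ᵇ t ≡ true → s ≡ t
=ᵇ⇒≡ []          []          _ = refl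
=ᵇ⇒≡ (true ∷ s)  (true ∷ t)  e = cong (true ∷_) (=ᵇ⇒≡ s t e)
=ᵇ⇒≡ (false ∷ s) (false ∷ t) e = cong (false ∷_) (=ᵇ⇒≡ s t e)

∣p∪q∣≤∣p∣+∣q∣ : ∀ {n} (p q : Subset n) → ∣ p ∪ q ∣ ℕ.≤ ∣ p ∣ + ∣ q ∣
∣p∪q∣≤∣p∣+∣q∣ []          []          = z≤n
∣p∪q∣≤∣p∣+∣q∣ (true ∷ p)  (x ∷ q)     =
  s≤s (ℕP.≤-trans (∣p∪q∣≤∣p∣+∣q∣ p q) (ℕP.+-monoʳ-≤ ∣ p ∣ (SubsetP.∣p∣≤∣x∷p∣ x q)))
∣p∪q∣≤∣p∣+∣q∣ (false ∷ p) (true ∷ q)  =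
  ℕP.≤-trans (s≤s (∣p∪q∣≤∣p∣+∣q∣ p q)) (ℕP.≤-reflexive (sym (ℕP.+-suc ∣ p ∣ ∣ q ∣)))
∣p∪q∣≤∣p∣+∣q∣ (false ∷ p) (false ∷ q) = ∣p∪q∣≤∣p∣+∣q∣ p q

∣p∣≡∣p∩q∣+∣p─q∣ : ∀ {n} (p q : Subset n) → ∣ p ∣ ≡ ∣ p ∩ q ∣ + ∣ p ─ q ∣
∣p∣≡∣p∩q∣+∣p─q∣ []          []          = refl
∣p∣≡∣p∩q∣+∣p─q∣ (true ∷ p)  (true ∷ q)  = cong suc (∣p∣≡∣p∩q∣+∣p─q∣ p q)
∣p∣≡∣p∩q∣+∣p─q∣ (true ∷ p)  (false ∷ q) = trans (cong suc (∣p∣≡∣p∩q∣+∣p─q∣ p q)) (sym (ℕP.+-suc _ _))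
∣p∣≡∣p∩q∣+∣p─q∣ (false ∷ p) (true ∷ q)  = ∣p∣≡∣p∩q∣+∣p─q∣ p q
∣p∣≡∣p∩q∣+∣p─q∣ (false ∷ p) (false ∷ q) = ∣p∣≡∣p∩q∣+∣p─q∣ p q

∣p∣≤∣p─q∣+∣q∣ : ∀ {n} (p q : Subset n) → ∣ p ∣ ℕ.≤ ∣ p ─ q ∣ + ∣ q ∣
∣p∣≤∣p─q∣+∣q∣ p q = begin
  ∣ p ∣                 ≡⟨ ∣p∣≡∣p∩q∣+∣p─q∣ p q ⟩
  ∣ p ∩ q ∣ + ∣ p ─ q ∣ ≤⟨ ℕP.+-monoˡ-≤ ∣ p ─ q ∣ (SubsetP.∣p∩q∣≤∣q∣ p q) ⟩
  ∣ q ∣ + ∣ p ─ q ∣     ≡⟨ ℕP.+-comm ∣ q ∣ ∣ p ─ q ∣ ⟩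
  ∣ p ─ q ∣ + ∣ q ∣     ∎
  where open ℕP.≤-Reasoning

p∪[q─p]≡q : ∀ {n} (p q : Subset n) → p ⊆ᵇ q ≡ true → p ∪ (q ─ p) ≡ q
p∪[q─p]≡q []          []         _ = refl
p∪[q─p]≡q (true ∷ p)  (true ∷ q) e = cong (true ∷_) (p∪[q─p]≡q p q e)
p∪[q─p]≡q (false ∷ p) (x ∷ q)    e = cong (x ∷_) (p∪[q─p]≡q p q e)

∣q─p∣+∣p∣≡∣q∣ : ∀ {n} (p q : Subset n) → p ⊆ᵇ q ≡ true → ∣ q ─ p ∣ + ∣ p ∣ ≡ ∣ q ∣
∣q─p∣+∣p∣≡∣q∣ []          []          _ = refl
∣q─p∣+∣p∣≡∣q∣ (true ∷ p)  (true ∷ q)  e = trans (ℕP.+-suc _ _) (cong suc (∣q─p∣+∣p∣≡∣q∣ p q e))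
∣q─p∣+∣p∣≡∣q∣ (false ∷ p) (true ∷ q)  e = cong suc (∣q─p∣+∣p∣≡∣q∣ p q e)
∣q─p∣+∣p∣≡∣q∣ (false ∷ p) (false ∷ q) e = ∣q─p∣+∣p∣≡∣q∣ p q e

s⊆ᵇc∪h⇒s─c⊆ᵇh : ∀ {n} (s c h : Subset n) → s ⊆ᵇ (c ∪ h) ≡ true → (s ─ c) ⊆ᵇ h ≡ true
s⊆ᵇc∪h⇒s─c⊆ᵇh []          []          []      _ = refl
s⊆ᵇc∪h⇒s─c⊆ᵇh (x ∷ s)     (true ∷ c)  (_ ∷ h) e = s⊆ᵇc∪h⇒s─c⊆ᵇh s c h (∧-elimʳ {not x ∨ true} e)
s⊆ᵇc∪h⇒s─c⊆ᵇh (true ∷ s)  (false ∷ c) (true ∷ h) e = s⊆ᵇc∪h⇒s─c⊆ᵇh s c h e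
s⊆ᵇc∪h⇒s─c⊆ᵇh (false ∷ s) (false ∷ c) (_ ∷ h) e = s⊆ᵇc∪h⇒s─c⊆ᵇh s c h e

⊆ᵇ∧∣∣≥⇒≡ : ∀ {n} (s x : Subset n) → s ⊆ᵇ x ≡ true → ∣ x ∣ ℕ.≤ ∣ s ∣ → s ≡ x
⊆ᵇ∧∣∣≥⇒≡ []          []          _ _ = refl
⊆ᵇ∧∣∣≥⇒≡ (true ∷ s)  (true ∷ x)  e l = cong (true ∷_) (⊆ᵇ∧∣∣≥⇒≡ s x e (ℕP.≤-pred l))
⊆ᵇ∧∣∣≥⇒≡ (false ∷ s) (true ∷ x)  e l = contradiction (ℕP.≤-trans l (⊆ᵇ⇒∣∣≤ s x e)) ℕP.1+n≰n
⊆ᵇ∧∣∣≥⇒≡ (false ∷ s) (false ∷ x) e l = cong (false ∷_) (⊆ᵇ∧∣∣≥⇒≡ s x e l)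

⊆ᵇ-interpolate : ∀ {n} (t s : Subset n) k → t ⊆ᵇ s ≡ true → ∣ t ∣ ℕ.≤ k → k ℕ.≤ ∣ s ∣ →
                 Σ (Subset n) (λ u → (t ⊆ᵇ u ≡ true) × (u ⊆ᵇ s ≡ true) × (∣ u ∣ ≡ k))
⊆ᵇ-interpolate []          []          zero    _ _ _ = [] , refl , refl , refl
⊆ᵇ-interpolate (true ∷ t)  (true ∷ s)  (suc k) e (s≤s t≤k) (s≤s k≤s)
  with u , t⊆u , u⊆s , ∣u∣≡k ← ⊆ᵇ-interpolate t s k e t≤k k≤s =
  true ∷ u , t⊆u , u⊆s , cong suc ∣u∣≡k
⊆ᵇ-interpolate (false ∷ t) (false ∷ s) k       e t≤k k≤s
  with u , t⊆u , u⊆s , ∣u∣≡k ← ⊆ᵇ-interpolate t s k e t≤k k≤s =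
  false ∷ u , t⊆u , u⊆s , ∣u∣≡k
⊆ᵇ-interpolate (false ∷ t) (true ∷ s)  k       e t≤k k≤1+s with k ℕP.≤? ∣ s ∣
... | yes k≤s with u , t⊆u , u⊆s , ∣u∣≡k ← ⊆ᵇ-interpolate t s k e t≤k k≤s =
  false ∷ u , t⊆u , u⊆s , ∣u∣≡k
⊆ᵇ-interpolate (false ∷ t) (true ∷ s)  zero    e t≤k k≤1+s | no k≰s = contradiction z≤n k≰s
⊆ᵇ-interpolate (false ∷ t) (true ∷ s)  (suc k) e t≤k (s≤s k≤s) | no k≰s
  with u , t⊆u , u⊆s , ∣u∣≡k ← ⊆ᵇ-interpolate t s k e (ℕP.≤-trans (⊆ᵇ⇒∣∣≤ t s e) (ℕP.≤-pred (ℕP.≰⇒> k≰s))) k≤s =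
  true ∷ u , t⊆u , u⊆s , cong suc ∣u∣≡k

∣U∣≤∣U─F∣+∣F∣*i : ∀ {n} (U : Subset n) (F : List (Subset n)) i → (∀ f → f ∈ F → ∣ f ∣ ≡ i) →
                  ∣ U ∣ ℕ.≤ ∣ foldr (λ f U → U ─ f) U F ∣ + length F * i
∣U∣≤∣U─F∣+∣F∣*i U []      i _     = ℕP.≤-reflexive (sym (ℕP.+-identityʳ ∣ U ∣))
∣U∣≤∣U─F∣+∣F∣*i U (f ∷ F) i sizes = begin
  ∣ U ∣                                ≤⟨ ∣U∣≤∣U─F∣+∣F∣*i U F i (λ g g∈F → sizes g (there g∈F)) ⟩
  ∣ W ∣ + length F * i                 ≤⟨ ℕP.+-monoˡ-≤ (length F * i) (∣p∣≤∣p─q∣+∣q∣ W f) ⟩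
  ∣ W ─ f ∣ + ∣ f ∣ + length F * i     ≡⟨ ℕP.+-assoc ∣ W ─ f ∣ ∣ f ∣ (length F * i) ⟩
  ∣ W ─ f ∣ + (∣ f ∣ + length F * i)   ≡⟨ cong (λ k → ∣ W ─ f ∣ + (k + length F * i)) (sizes f (here refl)) ⟩
  ∣ W ─ f ∣ + (i + length F * i)       ∎
  where
  open ℕP.≤-Reasoning
  W = foldr (λ f U → U ─ f) U F

indicator : Bool → ℕ
indicator true  = 1
indicator false = 0

sumSubsets : ∀ {n} → (Subset n → ℕ) → ℕ
sumSubsets {zero}  f = f []
sumSubsets {suc n} f = sumSubsets (λ x → f (true ∷ x)) + sumSubsets (λ x → f (false ∷ x))

length-filterᵇ-++ : ∀ {A : Set} (P : A → Bool) xs ys →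
                    length (filterᵇ P (xs ++ ys)) ≡ length (filterᵇ P xs) + length (filterᵇ P ys)
length-filterᵇ-++ P xs ys =
  trans (cong length (ListP.filter-++ (λ x → T? (P x)) xs ys)) (ListP.length-++ (filterᵇ P xs))

length-filterᵇ-map : ∀ {A B : Set} (P : B → Bool) (g : A → B) xs →
                     length (filterᵇ P (map g xs)) ≡ length (filterᵇ (λ x → P (g x)) xs)
length-filterᵇ-map P g []       = refl
length-filterᵇ-map P g (x ∷ xs) with P (g x)
... | true  = cong suc (length-filterᵇ-map P g xs)
... | false = length-filterᵇ-map P g xs

count≡sumSubsets : ∀ {n} (P : Subset n → Bool) → count P ≡ sumSubsets (λ x → indicator (P x))
count≡sumSubsets {zero}  P with P []
... | true  = refl
... | false = refl
count≡sumSubsets {suc n} P =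
  trans (length-filterᵇ-++ P (map (inside ∷_) (allSubsets n)) (map (outside ∷_) (allSubsets n)))
        (cong₂ _+_ (trans (length-filterᵇ-map P (inside ∷_) (allSubsets n)) (count≡sumSubsets (λ x → P (true ∷ x))))
                   (trans (length-filterᵇ-map P (outside ∷_) (allSubsets n)) (count≡sumSubsets (λ x → P (false ∷ x)))))

sumSubsets-cong : ∀ {n} {f g : Subset n → ℕ} → (∀ x → f x ≡ g x) → sumSubsets f ≡ sumSubsets g
sumSubsets-cong {zero}  f≡g = f≡g []
sumSubsets-cong {suc n} f≡g =
  cong₂ _+_ (sumSubsets-cong (λ x → f≡g (true ∷ x))) (sumSubsets-cong (λ x → f≡g (false ∷ x)))

sumSubsets-mono-≤ : ∀ {n} {f g : Subset n → ℕ} → (∀ x → f x ℕ.≤ g x) → sumSubsets f ℕ.≤ sumSubsets g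
sumSubsets-mono-≤ {zero}  f≤g = f≤g []
sumSubsets-mono-≤ {suc n} f≤g =
  ℕP.+-mono-≤ (sumSubsets-mono-≤ (λ x → f≤g (true ∷ x))) (sumSubsets-mono-≤ (λ x → f≤g (false ∷ x)))

sumSubsets-+ : ∀ {n} (f g : Subset n → ℕ) → sumSubsets (λ x → f x + g x) ≡ sumSubsets f + sumSubsets g
sumSubsets-+ {zero}  f g = refl
sumSubsets-+ {suc n} f g = begin
  sumSubsets (λ x → f (true ∷ x) + g (true ∷ x)) + sumSubsets (λ x → f (false ∷ x) + g (false ∷ x))
    ≡⟨ cong₂ _+_ (sumSubsets-+ (λ x → f (true ∷ x)) (λ x → g (true ∷ x)))
                 (sumSubsets-+ (λ x → f (false ∷ x)) (λ x → g (false ∷ x))) ⟩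
  (f₁ + g₁) + (f₀ + g₀)
    ≡⟨ solve 4 (λ a b c d → (a :+ b) :+ (c :+ d) := (a :+ c) :+ (b :+ d)) refl f₁ g₁ f₀ g₀ ⟩
  (f₁ + f₀) + (g₁ + g₀) ∎
  where
  open ≡-Reasoning
  open +-*-Solver
  f₁ = sumSubsets (λ x → f (true ∷ x))
  f₀ = sumSubsets (λ x → f (false ∷ x))
  g₁ = sumSubsets (λ x → g (true ∷ x))
  g₀ = sumSubsets (λ x → g (false ∷ x))

sumSubsets-zero : ∀ {n} → sumSubsets {n} (λ _ → 0) ≡ 0
sumSubsets-zero {zero}  = refl
sumSubsets-zero {suc n} = cong₂ _+_ (sumSubsets-zero {n}) (sumSubsets-zero {n})

sumSubsets-*ˡ : ∀ {n} c (f : Subset n → ℕ) → sumSubsets (λ x → c * f x) ≡ c * sumSubsets f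
sumSubsets-*ˡ {zero}  c f = refl
sumSubsets-*ˡ {suc n} c f =
  trans (cong₂ _+_ (sumSubsets-*ˡ c (λ x → f (true ∷ x))) (sumSubsets-*ˡ c (λ x → f (false ∷ x))))
        (sym (ℕP.*-distribˡ-+ c (sumSubsets (λ x → f (true ∷ x))) (sumSubsets (λ x → f (false ∷ x)))))

sumSubsets-comm : ∀ {n m} (g : Subset n → Subset m → ℕ) →
                  sumSubsets (λ x → sumSubsets (λ y → g x y)) ≡ sumSubsets (λ y → sumSubsets (λ x → g x y))
sumSubsets-comm {zero}  g = refl
sumSubsets-comm {suc n} g = begin
  sumSubsets (λ x → sumSubsets (g (true ∷ x))) + sumSubsets (λ x → sumSubsets (g (false ∷ x)))
    ≡⟨ cong₂ _+_ (sumSubsets-comm (λ x → g (true ∷ x))) (sumSubsets-comm (λ x → g (false ∷ x))) ⟩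
  sumSubsets (λ y → sumSubsets (λ x → g (true ∷ x) y)) + sumSubsets (λ y → sumSubsets (λ x → g (false ∷ x) y))
    ≡⟨ sym (sumSubsets-+ (λ y → sumSubsets (λ x → g (true ∷ x) y)) (λ y → sumSubsets (λ x → g (false ∷ x) y))) ⟩
  sumSubsets (λ y → sumSubsets (λ x → g (true ∷ x) y) + sumSubsets (λ x → g (false ∷ x) y)) ∎
  where open ≡-Reasoning

term≤sumSubsets : ∀ {n} (f : Subset n → ℕ) x → f x ℕ.≤ sumSubsets f
term≤sumSubsets {zero}  f []          = ℕP.≤-refl
term≤sumSubsets {suc n} f (true ∷ x)  = ℕP.≤-trans (term≤sumSubsets (λ y → f (true ∷ y)) x) (ℕP.m≤m+n _ _)
term≤sumSubsets {suc n} f (false ∷ x) = ℕP.≤-trans (term≤sumSubsets (λ y → f (false ∷ y)) x) (ℕP.m≤n+m _ _)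

count-cong : ∀ {n} (P Q : Subset n → Bool) → (∀ x → P x ≡ Q x) → count P ≡ count Q
count-cong P Q P≡Q rewrite count≡sumSubsets P | count≡sumSubsets Q = sumSubsets-cong (λ x → cong indicator (P≡Q x))

count-none : ∀ {n} (P : Subset n → Bool) → (∀ x → P x ≡ false) → count P ≡ 0
count-none {n} P none = trans (count-cong P (λ _ → false) none) (trans (count≡sumSubsets {n} _) (sumSubsets-zero {n}))

count-mono-≤ : ∀ {n} (P Q : Subset n → Bool) → (∀ x → P x ≡ true → Q x ≡ true) → count P ℕ.≤ count Q
count-mono-≤ P Q P⇒Q rewrite count≡sumSubsets P | count≡sumSubsets Q = sumSubsets-mono-≤ pointwise
  where
  pointwise : ∀ x → indicator (P x) ℕ.≤ indicator (Q x)
  pointwise x with P x in eq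
  ... | false = z≤n
  ... | true rewrite P⇒Q x eq = ℕP.≤-refl

count-≤-+ : ∀ {n} (P Q B : Subset n → Bool) → (∀ x → P x ≡ true → Q x ≡ true ⊎ B x ≡ true) →
            count P ℕ.≤ count Q + count B
count-≤-+ P Q B P⇒Q⊎B rewrite count≡sumSubsets P | count≡sumSubsets Q | count≡sumSubsets B =
  ℕP.≤-trans (sumSubsets-mono-≤ pointwise) (ℕP.≤-reflexive (sumSubsets-+ (λ x → indicator (Q x)) (λ x → indicator (B x))))
  where
  pointwise : ∀ x → indicator (P x) ℕ.≤ indicator (Q x) + indicator (B x)
  pointwise x with P x in eq
  ... | false = z≤n
  ... | true with P⇒Q⊎B x eq
  ...   | inj₁ Qx rewrite Qx = s≤s z≤n
  ...   | inj₂ Bx rewrite Bx = ℕP.m≤n+m 1 (indicator (Q x))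

count-suc : ∀ {n} (P : Subset (suc n) → Bool) →
            count P ≡ count (λ x → P (true ∷ x)) + count (λ x → P (false ∷ x))
count-suc P = trans (count≡sumSubsets P)
  (sym (cong₂ _+_ (count≡sumSubsets (λ x → P (true ∷ x))) (count≡sumSubsets (λ x → P (false ∷ x)))))

count-≤-sumSubsets-fibres : ∀ {n} (P A : Subset n → Bool) (B : Subset n → Subset n → Bool) →
  (∀ h → P h ≡ true → Σ (Subset n) (λ s → (A s ≡ true) × (B s h ≡ true))) →
  count P ℕ.≤ sumSubsets (λ s → indicator (A s) * count (B s))
count-≤-sumSubsets-fibres P A B covered = begin
  count P
    ≡⟨ count≡sumSubsets P ⟩
  sumSubsets (λ h → indicator (P h))
    ≤⟨ sumSubsets-mono-≤ pointwise ⟩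
  sumSubsets (λ h → sumSubsets (λ s → indicator (A s) * indicator (B s h)))
    ≡⟨ sumSubsets-comm (λ h s → indicator (A s) * indicator (B s h)) ⟩
  sumSubsets (λ s → sumSubsets (λ h → indicator (A s) * indicator (B s h)))
    ≡⟨ sumSubsets-cong (λ s → trans (sumSubsets-*ˡ (indicator (A s)) (λ h → indicator (B s h)))
                                    (cong (indicator (A s) *_) (sym (count≡sumSubsets (B s))))) ⟩
  sumSubsets (λ s → indicator (A s) * count (B s)) ∎
  where
  open ℕP.≤-Reasoning
  pointwise : ∀ h → indicator (P h) ℕ.≤ sumSubsets (λ s → indicator (A s) * indicator (B s h))
  pointwise h with P h in eq
  ... | false = z≤n
  ... | true with s , As , Bsh ← covered h eq =
    ℕP.≤-trans (ℕP.≤-reflexive (sym (cong₂ (λ a b → indicator a * indicator b) As Bsh)))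
               (term≤sumSubsets (λ s → indicator (A s) * indicator (B s h)) s)

toℚ-weighted-sumSubsets-≤ : ∀ {n} (A : Subset n → Bool) (g : Subset n → ℕ) (M : ℚ) →
  (∀ s → A s ≡ true → toℚ (g s) ℚ.≤ M) →
  toℚ (sumSubsets (λ s → indicator (A s) * g s)) ℚ.≤ toℚ (sumSubsets (λ s → indicator (A s))) ℚ.* M
toℚ-weighted-sumSubsets-≤ {zero} A g M g≤M with A [] in eq
... | false = ℚP.≤-reflexive (trans toℚ-0 (sym (trans (cong (ℚ._* M) toℚ-0) (ℚP.*-zeroˡ M))))
... | true  = begin
  toℚ (1 * g [])  ≡⟨ cong toℚ (ℕP.*-identityˡ (g [])) ⟩
  toℚ (g [])      ≤⟨ g≤M [] eq ⟩
  M               ≡⟨ sym (ℚP.*-identityˡ M) ⟩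
  1ℚ ℚ.* M        ≡⟨ cong (ℚ._* M) (sym toℚ-1) ⟩
  toℚ 1 ℚ.* M     ∎
  where open ℚP.≤-Reasoning
toℚ-weighted-sumSubsets-≤ {suc n} A g M g≤M = begin
  toℚ (w₁ + w₀)                  ≡⟨ toℚ-+ w₁ w₀ ⟩
  toℚ w₁ ℚ.+ toℚ w₀              ≤⟨ ℚP.+-mono-≤
      (toℚ-weighted-sumSubsets-≤ (λ x → A (true ∷ x)) (λ x → g (true ∷ x)) M (λ s → g≤M (true ∷ s)))
      (toℚ-weighted-sumSubsets-≤ (λ x → A (false ∷ x)) (λ x → g (false ∷ x)) M (λ s → g≤M (false ∷ s))) ⟩
  toℚ a₁ ℚ.* M ℚ.+ toℚ a₀ ℚ.* M  ≡⟨ sym (ℚP.*-distribʳ-+ M (toℚ a₁) (toℚ a₀)) ⟩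
  (toℚ a₁ ℚ.+ toℚ a₀) ℚ.* M      ≡⟨ cong (ℚ._* M) (sym (toℚ-+ a₁ a₀)) ⟩
  toℚ (a₁ + a₀) ℚ.* M            ∎
  where
  open ℚP.≤-Reasoning
  w₁ = sumSubsets (λ s → indicator (A (true ∷ s)) * g (true ∷ s))
  w₀ = sumSubsets (λ s → indicator (A (false ∷ s)) * g (false ∷ s))
  a₁ = sumSubsets (λ s → indicator (A (true ∷ s)))
  a₀ = sumSubsets (λ s → indicator (A (false ∷ s)))

count-≤-by-fibres : ∀ {n} (P A : Subset n → Bool) (B : Subset n → Subset n → Bool) (M : ℚ) →
  (∀ h → P h ≡ true → Σ (Subset n) (λ s → (A s ≡ true) × (B s h ≡ true))) →
  (∀ s → A s ≡ true → toℚ (count (B s)) ℚ.≤ M) →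
  toℚ (count P) ℚ.≤ toℚ (count A) ℚ.* M
count-≤-by-fibres P A B M covered fibre≤M = begin
  toℚ (count P)                                               ≤⟨ toℚ-mono-≤ (count-≤-sumSubsets-fibres P A B covered) ⟩
  toℚ (sumSubsets (λ s → indicator (A s) * count (B s)))      ≤⟨ toℚ-weighted-sumSubsets-≤ A (λ s → count (B s)) M fibre≤M ⟩
  toℚ (sumSubsets (λ s → indicator (A s))) ℚ.* M              ≡⟨ cong (λ k → toℚ k ℚ.* M) (sym (count≡sumSubsets A)) ⟩
  toℚ (count A) ℚ.* M                                         ∎
  where open ℚP.≤-Reasoning

count-anyᵇ-≤ : ∀ {n} (b : Subset n → Bool) (P : Subset n → Subset n → Bool) (F : List (Subset n)) (M : ℚ) →
  (∀ f → f ∈ F → toℚ (count (λ h → b h ∧ P f h)) ℚ.≤ M) →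
  toℚ (count (λ h → b h ∧ anyᵇ (λ f → P f h) F)) ℚ.≤ toℚ (length F) ℚ.* M
count-anyᵇ-≤ b P [] M _ rewrite count-none (λ h → b h ∧ false) (λ h → BoolP.∧-zeroʳ (b h)) =
  ℚP.≤-reflexive (trans toℚ-0 (sym (trans (cong (ℚ._* M) toℚ-0) (ℚP.*-zeroˡ M))))
count-anyᵇ-≤ b P (f ∷ F) M bound = begin
  toℚ (count (λ h → b h ∧ (P f h ∨ anyᵇ (λ f → P f h) F)))
    ≤⟨ toℚ-mono-≤ (count-≤-+ _ (λ h → b h ∧ P f h) (λ h → b h ∧ anyᵇ (λ f → P f h) F) split) ⟩
  toℚ (count (λ h → b h ∧ P f h) + count (λ h → b h ∧ anyᵇ (λ f → P f h) F))
    ≡⟨ toℚ-+ (count (λ h → b h ∧ P f h)) (count (λ h → b h ∧ anyᵇ (λ f → P f h) F)) ⟩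
  toℚ (count (λ h → b h ∧ P f h)) ℚ.+ toℚ (count (λ h → b h ∧ anyᵇ (λ f → P f h) F))
    ≤⟨ ℚP.+-mono-≤ (bound f (here refl)) (count-anyᵇ-≤ b P F M (λ f' f'∈F → bound f' (there f'∈F))) ⟩
  M ℚ.+ toℚ (length F) ℚ.* M
    ≡⟨ solve 2 (λ M l → M :+ l :* M := (con 1ℚ :+ l) :* M) refl M (toℚ (length F)) ⟩
  (1ℚ ℚ.+ toℚ (length F)) ℚ.* M
    ≡⟨ cong (ℚ._* M) (sym (trans (toℚ-+ 1 (length F)) (cong (ℚ._+ toℚ (length F)) toℚ-1))) ⟩
  toℚ (suc (length F)) ℚ.* M ∎
  where
  open ℚP.≤-Reasoning
  open ℚSolver.+-*-Solver
  split : ∀ h → (b h ∧ (P f h ∨ anyᵇ (λ f → P f h) F)) ≡ true →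
          (b h ∧ P f h) ≡ true ⊎ (b h ∧ anyᵇ (λ f → P f h) F) ≡ true
  split h e with b h | P f h
  ... | true  | true  = inj₁ refl
  ... | true  | false = inj₂ e
  ... | false | _     = inj₁ e

supersetsOfSize : ∀ {n} → Subset n → ℕ → Subset n → Bool
supersetsOfSize d p h = (d ⊆ᵇ h) ∧ (∣ h ∣ ≡ᵇ p)

count-supersetsOfSize-< : ∀ {n} (d : Subset n) p → p ℕ.< ∣ d ∣ → count (supersetsOfSize d p) ≡ 0
count-supersetsOfSize-< d p p<d = count-none _ none
  where
  none : ∀ h → supersetsOfSize d p h ≡ false
  none h with d ⊆ᵇ h in d⊆h
  ... | false = refl
  ... | true  = ≢⇒≡ᵇ-false ∣ h ∣ p λ h≡p →
    ℕP.<-irrefl refl (ℕP.<-≤-trans p<d (ℕP.≤-trans (⊆ᵇ⇒∣∣≤ d h d⊆h) (ℕP.≤-reflexive h≡p)))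

count-supersetsOfSize-≤ : ∀ {n} (d : Subset n) p → count (supersetsOfSize d p) ℕ.≤ n ^ (p ∸ ∣ d ∣)
count-supersetsOfSize-≤ []          zero    = ℕP.≤-refl
count-supersetsOfSize-≤ []          (suc p) = z≤n
count-supersetsOfSize-≤ (true ∷ d)  zero
  rewrite count-supersetsOfSize-< (true ∷ d) zero (s≤s z≤n) = z≤n
count-supersetsOfSize-≤ {suc n} (true ∷ d) (suc p) = begin
  count (supersetsOfSize (true ∷ d) (suc p))       ≡⟨ count-suc (supersetsOfSize (true ∷ d) (suc p)) ⟩
  count (supersetsOfSize d p) + count {n} (λ _ → false)
    ≡⟨ cong (λ m → count (supersetsOfSize d p) + m) (count-none {n} _ (λ _ → refl)) ⟩
  count (supersetsOfSize d p) + 0                  ≤⟨ ℕP.+-monoˡ-≤ 0 (count-supersetsOfSize-≤ d p) ⟩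
  n ^ (p ∸ ∣ d ∣) + 0                              ≤⟨ ℕP.+-monoˡ-≤ 0 (ℕP.^-monoˡ-≤ (p ∸ ∣ d ∣) (ℕP.n≤1+n n)) ⟩
  suc n ^ (p ∸ ∣ d ∣) + 0                          ≡⟨ ℕP.+-identityʳ _ ⟩
  suc n ^ (p ∸ ∣ d ∣)                              ∎
  where open ℕP.≤-Reasoning
count-supersetsOfSize-≤ {suc n} (false ∷ d) zero = begin
  count (supersetsOfSize (false ∷ d) zero)          ≡⟨ count-suc (supersetsOfSize (false ∷ d) zero) ⟩
  count (λ h → (d ⊆ᵇ h) ∧ false) + count (supersetsOfSize d zero)
    ≡⟨ cong (_+ count (supersetsOfSize d zero)) (count-none _ (λ h → BoolP.∧-zeroʳ (d ⊆ᵇ h))) ⟩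
  count (supersetsOfSize d zero)                    ≤⟨ count-supersetsOfSize-≤ d zero ⟩
  n ^ (0 ∸ ∣ d ∣)                                   ≡⟨ cong (n ^_) (ℕP.0∸n≡0 ∣ d ∣) ⟩
  1                                                 ≡⟨ cong (suc n ^_) (sym (ℕP.0∸n≡0 ∣ d ∣)) ⟩
  suc n ^ (0 ∸ ∣ d ∣)                               ∎
  where open ℕP.≤-Reasoning
count-supersetsOfSize-≤ {suc n} (false ∷ d) (suc p) with ∣ d ∣ ℕP.≤? p
... | yes d≤p = begin
  count (supersetsOfSize (false ∷ d) (suc p))       ≡⟨ count-suc (supersetsOfSize (false ∷ d) (suc p)) ⟩
  count (supersetsOfSize d p) + count (supersetsOfSize d (suc p))
    ≤⟨ ℕP.+-mono-≤ (count-supersetsOfSize-≤ d p) (count-supersetsOfSize-≤ d (suc p)) ⟩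
  n ^ k + n ^ (suc p ∸ ∣ d ∣)                       ≡⟨ cong (λ m → n ^ k + n ^ m) 1+p∸d ⟩
  n ^ k + n ^ suc k                                 ≤⟨ ^-suc-step n k ⟩
  suc n ^ suc k                                     ≡⟨ cong (suc n ^_) (sym 1+p∸d) ⟩
  suc n ^ (suc p ∸ ∣ d ∣)                           ∎
  where
  open ℕP.≤-Reasoning
  k = p ∸ ∣ d ∣
  1+p∸d : suc p ∸ ∣ d ∣ ≡ suc k
  1+p∸d = ℕP.+-∸-assoc 1 d≤p
... | no d≰p = begin
  count (supersetsOfSize (false ∷ d) (suc p))       ≡⟨ count-suc (supersetsOfSize (false ∷ d) (suc p)) ⟩
  count (supersetsOfSize d p) + count (supersetsOfSize d (suc p))
    ≡⟨ cong (_+ count (supersetsOfSize d (suc p))) (count-supersetsOfSize-< d p (ℕP.≰⇒> d≰p)) ⟩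
  count (supersetsOfSize d (suc p))                 ≤⟨ count-supersetsOfSize-≤ d (suc p) ⟩
  n ^ (suc p ∸ ∣ d ∣)                               ≤⟨ ℕP.^-monoˡ-≤ (suc p ∸ ∣ d ∣) (ℕP.n≤1+n n) ⟩
  suc n ^ (suc p ∸ ∣ d ∣)                           ∎
  where open ℕP.≤-Reasoning

count-subsets : ∀ {n} (c : Subset n) → count (λ t → t ⊆ᵇ c) ≡ 2 ^ ∣ c ∣
count-subsets []          = refl
count-subsets {suc n} (true ∷ c)
  rewrite count-suc (λ t → t ⊆ᵇ (true ∷ c)) | count-subsets c = cong (λ m → 2 ^ ∣ c ∣ + m) (sym (ℕP.+-identityʳ _))
count-subsets {suc n} (false ∷ c)
  rewrite count-suc (λ t → t ⊆ᵇ (false ∷ c)) | count-subsets c | count-none {n} (λ _ → false) (λ _ → refl) = refl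

count-=ᵇ-≤1 : ∀ {n} (c : Subset n) → count (λ s → s =ᵇ c) ℕ.≤ 1
count-=ᵇ-≤1 []          = ℕP.≤-refl
count-=ᵇ-≤1 {suc n} (true ∷ c)
  rewrite count-suc (λ s → s =ᵇ (true ∷ c)) | count-none {n} (λ _ → false) (λ _ → refl)
        | ℕP.+-identityʳ (count (λ s → s =ᵇ c)) = count-=ᵇ-≤1 c
count-=ᵇ-≤1 {suc n} (false ∷ c)
  rewrite count-suc (λ s → s =ᵇ (false ∷ c)) | count-none {n} (λ _ → false) (λ _ → refl) = count-=ᵇ-≤1 c

-- Sets completing an edge of a q-graph with small codegrees
containsEdge : ∀ {n} → ℕ → Hypergraph n → Subset n → Bool
containsEdge q Y x = anySubset (λ s → (s ⊆ᵇ x) ∧ (∣ s ∣ ≡ᵇ q) ∧ Y s)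

count-edges⊇-≤-∣link∣ : ∀ {n} q (Y : Hypergraph n) → (∀ s → Y s ≡ true → ∣ s ∣ ≡ q) → ∀ u →
                         toℚ (count (λ s → Y s ∧ (u ⊆ᵇ s))) ℚ.≤ toℚ (∣link∣ q Y u)
count-edges⊇-≤-∣link∣ {n} q Y Y-size u = begin
  toℚ (count (λ s → Y s ∧ (u ⊆ᵇ s)))   ≤⟨ count-≤-by-fibres (λ s → Y s ∧ (u ⊆ᵇ s)) linkSet (λ f s → s =ᵇ (u ∪ f))
                                             (toℚ 1) covered (λ f _ → toℚ-mono-≤ (count-=ᵇ-≤1 (u ∪ f))) ⟩
  toℚ (∣link∣ q Y u) ℚ.* toℚ 1        ≡⟨ cong (toℚ (∣link∣ q Y u) ℚ.*_) toℚ-1 ⟩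
  toℚ (∣link∣ q Y u) ℚ.* 1ℚ           ≡⟨ ℚP.*-identityʳ (toℚ (∣link∣ q Y u)) ⟩
  toℚ (∣link∣ q Y u)                  ∎
  where
  open ℚP.≤-Reasoning
  linkSet : Subset n → Bool
  linkSet f = (∣ f ∣ ≡ᵇ (q ∸ ∣ u ∣)) ∧ Y (u ∪ f)
  covered : ∀ s → (Y s ∧ (u ⊆ᵇ s)) ≡ true → Σ (Subset n) (λ f → (linkSet f ≡ true) × ((s =ᵇ (u ∪ f)) ≡ true))
  covered s e = s ─ u , ∧-intro (≡⇒≡ᵇ _ _ ∣s─u∣≡q∸∣u∣) (subst (λ x → Y x ≡ true) (sym u∪[s─u]≡s) (∧-elimˡ e))
                      , subst (λ x → (s =ᵇ x) ≡ true) (sym u∪[s─u]≡s) (=ᵇ-refl s)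
    where
    u⊆s = ∧-elimʳ {Y s} e
    u∪[s─u]≡s : u ∪ (s ─ u) ≡ s
    u∪[s─u]≡s = p∪[q─p]≡q u s u⊆s
    ∣s─u∣≡q∸∣u∣ : ∣ s ─ u ∣ ≡ q ∸ ∣ u ∣
    ∣s─u∣≡q∸∣u∣ = trans (sym (ℕP.m+n∸n≡m _ ∣ u ∣)) (cong (_∸ ∣ u ∣) (trans (∣q─p∣+∣p∣≡∣q∣ u s u⊆s) (Y-size s (∧-elimˡ e))))

module UsedEdgeCounts {n : ℕ} (Y : Hypergraph n) (q r : ℕ) (ε : ℚ) (0≤ε : 0ℚ ℚ.≤ ε) (r≤q : r ℕ.≤ q)
  (Y-size : ∀ s → Y s ≡ true → ∣ s ∣ ≡ q)
  (Δ : ∀ u → ∣ u ∣ ≡ r → toℚ (∣link∣ q Y u) ℚ.≤ ε ℚ.* toℚ (n ^ (q ∸ r))) where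

  count-edges⊇-≤ : ∀ t → ∣ t ∣ ℕ.≤ r →
    toℚ (count (λ s → Y s ∧ (t ⊆ᵇ s))) ℚ.≤ toℚ (n ^ (r ∸ ∣ t ∣)) ℚ.* (ε ℚ.* toℚ (n ^ (q ∸ r)))
  count-edges⊇-≤ t t≤r = begin
    toℚ (count (λ s → Y s ∧ (t ⊆ᵇ s)))
      ≤⟨ count-≤-by-fibres (λ s → Y s ∧ (t ⊆ᵇ s)) (supersetsOfSize t r) (λ u s → Y s ∧ (u ⊆ᵇ s)) (ε ℚ.* N) covered fibre≤ ⟩
    toℚ (count (supersetsOfSize t r)) ℚ.* (ε ℚ.* N)
      ≤⟨ *-monoʳ-≤-0≤ (ε ℚ.* N) (0≤* 0≤ε (0≤toℚ (n ^ (q ∸ r)))) (toℚ-mono-≤ (count-supersetsOfSize-≤ t r)) ⟩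
    toℚ (n ^ (r ∸ ∣ t ∣)) ℚ.* (ε ℚ.* N) ∎
    where
    open ℚP.≤-Reasoning
    N = toℚ (n ^ (q ∸ r))
    covered : ∀ s → (Y s ∧ (t ⊆ᵇ s)) ≡ true →
              Σ (Subset n) (λ u → (supersetsOfSize t r u ≡ true) × ((Y s ∧ (u ⊆ᵇ s)) ≡ true))
    covered s e
      with u , t⊆u , u⊆s , ∣u∣≡r ← ⊆ᵇ-interpolate t s r (∧-elimʳ {Y s} e) t≤r
                                     (ℕP.≤-trans r≤q (ℕP.≤-reflexive (sym (Y-size s (∧-elimˡ e))))) =
      u , ∧-intro t⊆u (≡⇒≡ᵇ _ _ ∣u∣≡r) , ∧-intro (∧-elimˡ e) u⊆s
    fibre≤ : ∀ u → supersetsOfSize t r u ≡ true → toℚ (count (λ s → Y s ∧ (u ⊆ᵇ s))) ℚ.≤ ε ℚ.* N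
    fibre≤ u e = ℚP.≤-trans (count-edges⊇-≤-∣link∣ q Y Y-size u) (Δ u (≡ᵇ⇒≡ _ _ (∧-elimʳ {t ⊆ᵇ u} e)))

  edgeWithTrace : Subset n → Subset n → Subset n → Bool
  edgeWithTrace c t s = Y s ∧ ((s ∩ c) =ᵇ t)

  extendsTrace : Subset n → Subset n → Subset n → Bool
  extendsTrace c t h = anySubset (λ s → edgeWithTrace c t s ∧ ((s ─ c) ⊆ᵇ h))

  ∣s─c∣≡q∸∣t∣ : ∀ c t s → edgeWithTrace c t s ≡ true → ∣ s ─ c ∣ ≡ q ∸ ∣ t ∣
  ∣s─c∣≡q∸∣t∣ c t s e = begin
    ∣ s ─ c ∣                       ≡⟨ sym (ℕP.m+n∸m≡n ∣ t ∣ ∣ s ─ c ∣) ⟩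
    ∣ t ∣ + ∣ s ─ c ∣ ∸ ∣ t ∣       ≡⟨ cong (λ x → ∣ x ∣ + ∣ s ─ c ∣ ∸ ∣ t ∣) (sym s∩c≡t) ⟩
    ∣ s ∩ c ∣ + ∣ s ─ c ∣ ∸ ∣ t ∣   ≡⟨ cong (_∸ ∣ t ∣) (sym (∣p∣≡∣p∩q∣+∣p─q∣ s c)) ⟩
    ∣ s ∣ ∸ ∣ t ∣                   ≡⟨ cong (_∸ ∣ t ∣) (Y-size s (∧-elimˡ e)) ⟩
    q ∸ ∣ t ∣                       ∎
    where
    open ≡-Reasoning
    s∩c≡t = =ᵇ⇒≡ (s ∩ c) t (∧-elimʳ {Y s} e)

  count-extendsTrace-≤-by-fibres : ∀ c t i M →
    (∀ s → edgeWithTrace c t s ≡ true → toℚ (count (supersetsOfSize (s ─ c) (q ∸ i))) ℚ.≤ M) →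
    toℚ (count (λ h → (∣ h ∣ ≡ᵇ (q ∸ i)) ∧ extendsTrace c t h)) ℚ.≤ toℚ (count (edgeWithTrace c t)) ℚ.* M
  count-extendsTrace-≤-by-fibres c t i M =
    count-≤-by-fibres (λ h → (∣ h ∣ ≡ᵇ (q ∸ i)) ∧ extendsTrace c t h) (edgeWithTrace c t)
                      (λ s → supersetsOfSize (s ─ c) (q ∸ i)) M covered
    where
    covered : ∀ h → ((∣ h ∣ ≡ᵇ (q ∸ i)) ∧ extendsTrace c t h) ≡ true →
              Σ (Subset n) (λ s → (edgeWithTrace c t s ≡ true) × (supersetsOfSize (s ─ c) (q ∸ i) h ≡ true))
    covered h e with s , p ← anySubset-elim _ (∧-elimʳ {∣ h ∣ ≡ᵇ (q ∸ i)} e) =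
      s , ∧-elimˡ p , ∧-intro (∧-elimʳ {edgeWithTrace c t s} p) (∧-elimˡ e)

  count-extendsTrace-≤ : ∀ c t i → i ℕ.≤ r → ∣ t ∣ ℕ.≤ r →
    toℚ (count (λ h → (∣ h ∣ ≡ᵇ (q ∸ i)) ∧ extendsTrace c t h)) ℚ.≤ ε ℚ.* toℚ (n ^ (q ∸ i))
  count-extendsTrace-≤ c t i i≤r t≤r = bound (i ℕP.≤? ∣ t ∣)
    where
    bound : Dec (i ℕ.≤ ∣ t ∣) →
            toℚ (count (λ h → (∣ h ∣ ≡ᵇ (q ∸ i)) ∧ extendsTrace c t h)) ℚ.≤ ε ℚ.* toℚ (n ^ (q ∸ i))
    bound (yes i≤t) = begin
        toℚ (count (λ h → (∣ h ∣ ≡ᵇ (q ∸ i)) ∧ extendsTrace c t h))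
          ≤⟨ count-extendsTrace-≤-by-fibres c t i (toℚ (n ^ (∣ t ∣ ∸ i))) fibre≤ ⟩
        toℚ (count (edgeWithTrace c t)) ℚ.* toℚ (n ^ (∣ t ∣ ∸ i))
          ≤⟨ *-monoʳ-≤-0≤ (toℚ (n ^ (∣ t ∣ ∸ i))) (0≤toℚ (n ^ (∣ t ∣ ∸ i)))
               (ℚP.≤-trans (toℚ-mono-≤ (count-mono-≤ (edgeWithTrace c t) (λ s → Y s ∧ (t ⊆ᵇ s)) edge⊇t))
                           (count-edges⊇-≤ t t≤r)) ⟩
        toℚ (n ^ (r ∸ ∣ t ∣)) ℚ.* (ε ℚ.* toℚ (n ^ (q ∸ r))) ℚ.* toℚ (n ^ (∣ t ∣ ∸ i))
          ≡⟨ solve 4 (λ a e b c → a :* (e :* b) :* c := e :* (a :* b :* c)) refl (toℚ a₁) ε (toℚ a₂) (toℚ a₃) ⟩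
        ε ℚ.* (toℚ (n ^ (r ∸ ∣ t ∣)) ℚ.* toℚ (n ^ (q ∸ r)) ℚ.* toℚ (n ^ (∣ t ∣ ∸ i)))
          ≡⟨ cong (ε ℚ.*_) (sym (trans (toℚ-* (a₁ * a₂) a₃) (cong (ℚ._* toℚ a₃) (toℚ-* a₁ a₂)))) ⟩
        ε ℚ.* toℚ (n ^ (r ∸ ∣ t ∣) * n ^ (q ∸ r) * n ^ (∣ t ∣ ∸ i))
          ≡⟨ cong (λ x → ε ℚ.* toℚ x) (^[r∸k]*^[q∸r]*^[k∸i]≡^[q∸i] n i≤t t≤r r≤q) ⟩
        ε ℚ.* toℚ (n ^ (q ∸ i)) ∎
        where
        open ℚP.≤-Reasoning
        open ℚSolver.+-*-Solver
        t≤q = ℕP.≤-trans t≤r r≤q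
        a₁ = n ^ (r ∸ ∣ t ∣)
        a₂ = n ^ (q ∸ r)
        a₃ = n ^ (∣ t ∣ ∸ i)
        fibre≤ : ∀ s → edgeWithTrace c t s ≡ true → toℚ (count (supersetsOfSize (s ─ c) (q ∸ i))) ℚ.≤ toℚ (n ^ (∣ t ∣ ∸ i))
        fibre≤ s e = toℚ-mono-≤ (ℕP.≤-trans (count-supersetsOfSize-≤ (s ─ c) (q ∸ i))
          (ℕP.≤-reflexive (cong (n ^_) (trans (cong ((q ∸ i) ∸_) (∣s─c∣≡q∸∣t∣ c t s e)) ([m∸o]∸[m∸n]≡n∸o i≤t t≤q)))))
        edge⊇t : ∀ s → edgeWithTrace c t s ≡ true → (Y s ∧ (t ⊆ᵇ s)) ≡ true
        edge⊇t s e = ∧-intro (∧-elimˡ e) (subst (λ x → (x ⊆ᵇ s) ≡ true) (=ᵇ⇒≡ (s ∩ c) t (∧-elimʳ {Y s} e)) (p∩q⊆ᵇp s c))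
    bound (no i≰t) = begin
        toℚ (count (λ h → (∣ h ∣ ≡ᵇ (q ∸ i)) ∧ extendsTrace c t h))
          ≤⟨ count-extendsTrace-≤-by-fibres c t i 0ℚ fibre≡0 ⟩
        toℚ (count (edgeWithTrace c t)) ℚ.* 0ℚ ≡⟨ ℚP.*-zeroʳ (toℚ (count (edgeWithTrace c t))) ⟩
        0ℚ                                     ≤⟨ 0≤* 0≤ε (0≤toℚ (n ^ (q ∸ i))) ⟩
        ε ℚ.* toℚ (n ^ (q ∸ i))                ∎
        where
        open ℚP.≤-Reasoning
        fibre≡0 : ∀ s → edgeWithTrace c t s ≡ true → toℚ (count (supersetsOfSize (s ─ c) (q ∸ i))) ℚ.≤ 0ℚ
        fibre≡0 s e = ℚP.≤-reflexive (trans (cong toℚ (count-supersetsOfSize-< (s ─ c) (q ∸ i) q∸i<∣s─c∣)) toℚ-0)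
          where
          q∸i<∣s─c∣ = ℕP.<-≤-trans (ℕP.∸-monoʳ-< (ℕP.≰⇒> i≰t) (ℕP.≤-trans i≤r r≤q))
                                   (ℕP.≤-reflexive (sym (∣s─c∣≡q∸∣t∣ c t s e)))

  count-containsEdge-≤ : ∀ c i → i ℕ.≤ r → ∣ c ∣ ℕ.≤ r →
    toℚ (count (λ h → (∣ h ∣ ≡ᵇ (q ∸ i)) ∧ containsEdge q Y (c ∪ h))) ℚ.≤ toℚ (2 ^ r) ℚ.* (ε ℚ.* toℚ (n ^ (q ∸ i)))
  count-containsEdge-≤ c i i≤r c≤r = begin
    toℚ (count (λ h → (∣ h ∣ ≡ᵇ (q ∸ i)) ∧ containsEdge q Y (c ∪ h)))
      ≤⟨ count-≤-by-fibres (λ h → (∣ h ∣ ≡ᵇ (q ∸ i)) ∧ containsEdge q Y (c ∪ h)) (λ t → t ⊆ᵇ c)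
                           (λ t h → (∣ h ∣ ≡ᵇ (q ∸ i)) ∧ extendsTrace c t h) M covered
           (λ t t⊆c → count-extendsTrace-≤ c t i i≤r (ℕP.≤-trans (⊆ᵇ⇒∣∣≤ t c t⊆c) c≤r)) ⟩
    toℚ (count (λ t → t ⊆ᵇ c)) ℚ.* M
      ≤⟨ *-monoʳ-≤-0≤ M (0≤* 0≤ε (0≤toℚ (n ^ (q ∸ i))))
           (toℚ-mono-≤ (ℕP.≤-trans (ℕP.≤-reflexive (count-subsets c)) (ℕP.^-monoʳ-≤ 2 c≤r))) ⟩
    toℚ (2 ^ r) ℚ.* M ∎
    where
    open ℚP.≤-Reasoning
    M = ε ℚ.* toℚ (n ^ (q ∸ i))
    covered : ∀ h → ((∣ h ∣ ≡ᵇ (q ∸ i)) ∧ containsEdge q Y (c ∪ h)) ≡ true →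
              Σ (Subset n) (λ t → ((t ⊆ᵇ c) ≡ true) × (((∣ h ∣ ≡ᵇ (q ∸ i)) ∧ extendsTrace c t h) ≡ true))
    covered h e with s , p ← anySubset-elim _ (∧-elimʳ {∣ h ∣ ≡ᵇ (q ∸ i)} e) =
      s ∩ c , p∩q⊆ᵇq s c ,
      ∧-intro (∧-elimˡ e) (anySubset-intro _ s (∧-intro (∧-intro Ys (=ᵇ-refl (s ∩ c))) (s⊆ᵇc∪h⇒s─c⊆ᵇh s c h (∧-elimˡ p))))
      where
      Ys = ∧-elimʳ {∣ s ∣ ≡ᵇ q} (∧-elimʳ {s ⊆ᵇ (c ∪ h)} p)

  containsEdge⇒link : ∀ c h → ∣ c ∣ ℕ.≤ r → ∣ h ∣ ≡ q ∸ r → containsEdge q Y (c ∪ h) ≡ true →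
                      (∣ c ∣ ≡ r) × (Y (c ∪ h) ≡ true)
  containsEdge⇒link c h c≤r ∣h∣≡q∸r hit with s , p ← anySubset-elim _ hit =
    ∣c∣≡r , subst (λ x → Y x ≡ true) s≡c∪h Ys
    where
    s⊆c∪h = ∧-elimˡ p
    ∣s∣≡q = ≡ᵇ⇒≡ ∣ s ∣ q (∧-elimˡ (∧-elimʳ {s ⊆ᵇ (c ∪ h)} p))
    Ys = ∧-elimʳ {∣ s ∣ ≡ᵇ q} (∧-elimʳ {s ⊆ᵇ (c ∪ h)} p)
    q≤∣h∣+∣c∣ : q ℕ.≤ ∣ h ∣ + ∣ c ∣
    q≤∣h∣+∣c∣ = begin
      q                 ≡⟨ sym ∣s∣≡q ⟩
      ∣ s ∣             ≤⟨ ⊆ᵇ⇒∣∣≤ s (c ∪ h) s⊆c∪h ⟩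
      ∣ c ∪ h ∣         ≤⟨ ∣p∪q∣≤∣p∣+∣q∣ c h ⟩
      ∣ c ∣ + ∣ h ∣     ≡⟨ ℕP.+-comm ∣ c ∣ ∣ h ∣ ⟩
      ∣ h ∣ + ∣ c ∣     ∎
      where open ℕP.≤-Reasoning
    ∣c∣≡r : ∣ c ∣ ≡ r
    ∣c∣≡r = ℕP.≤-antisym c≤r (subst (ℕ._≤ ∣ c ∣) (ℕP.m∸[m∸n]≡n r≤q)
              (ℕP.m≤n+o⇒m∸n≤o q (q ∸ r) (subst (λ x → q ℕ.≤ x + ∣ c ∣) ∣h∣≡q∸r q≤∣h∣+∣c∣)))
    s≡c∪h : s ≡ c ∪ h
    s≡c∪h = ⊆ᵇ∧∣∣≥⇒≡ s (c ∪ h) s⊆c∪h (ℕP.≤-trans (∣p∪q∣≤∣p∣+∣q∣ c h)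
              (ℕP.≤-reflexive (trans (cong₂ _+_ ∣c∣≡r ∣h∣≡q∸r) (trans (ℕP.m+[n∸m]≡n r≤q) (sym ∣s∣≡q)))))

  count-containsEdge-≤-Δ : ∀ c → ∣ c ∣ ℕ.≤ r →
    toℚ (count (λ h → (∣ h ∣ ≡ᵇ (q ∸ r)) ∧ containsEdge q Y (c ∪ h))) ℚ.≤ ε ℚ.* toℚ (n ^ (q ∸ r))
  count-containsEdge-≤-Δ c c≤r = bound (∣ c ∣ ℕP.≟ r)
    where
    hits : Subset n → Bool
    hits h = (∣ h ∣ ≡ᵇ (q ∸ r)) ∧ containsEdge q Y (c ∪ h)
    bound : Dec (∣ c ∣ ≡ r) → toℚ (count hits) ℚ.≤ ε ℚ.* toℚ (n ^ (q ∸ r))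
    bound (yes ∣c∣≡r) = ℚP.≤-trans (toℚ-mono-≤ (count-mono-≤ hits (λ h → (∣ h ∣ ≡ᵇ (q ∸ ∣ c ∣)) ∧ Y (c ∪ h)) inLink))
                                   (Δ c ∣c∣≡r)
      where
      inLink : ∀ h → hits h ≡ true → ((∣ h ∣ ≡ᵇ (q ∸ ∣ c ∣)) ∧ Y (c ∪ h)) ≡ true
      inLink h e = ∧-intro (subst (λ x → (∣ h ∣ ≡ᵇ (q ∸ x)) ≡ true) (sym ∣c∣≡r) (∧-elimˡ e))
        (proj₂ (containsEdge⇒link c h c≤r (≡ᵇ⇒≡ _ _ (∧-elimˡ e)) (∧-elimʳ {∣ h ∣ ≡ᵇ (q ∸ r)} e)))
    bound (no ∣c∣≢r) = ℚP.≤-trans (ℚP.≤-reflexive (trans (cong toℚ (count-none hits none)) toℚ-0))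
                                  (0≤* 0≤ε (0≤toℚ (n ^ (q ∸ r))))
      where
      none : ∀ h → hits h ≡ false
      none h = ¬true⇒false λ e →
        ∣c∣≢r (proj₁ (containsEdge⇒link c h c≤r (≡ᵇ⇒≡ _ _ (∧-elimˡ e)) (∧-elimʳ {∣ h ∣ ≡ᵇ (q ∸ r)} e)))

-- Full complexes survive small perturbations of their degrees
InLayer-transfer : ∀ {N} (K K' : Cx N) {r} → (∀ s → ∣ s ∣ ≡ r → E K' s ≡ E K s) →
                   ∀ e → InLayer K' r e → InLayer K r e
InLayer-transfer K K' sameLayer e (∣e∣≡r , e∈K') = ∣e∣≡r , trans (sym (sameLayer e ∣e∣≡r)) e∈K'

IsRegular-transfer : ∀ {N} (K K' : Cx N) {ε d q r} (C M : ℕ) (bad : Subset N → ℕ) →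
  0ℚ ℚ.≤ ε → suc C ℕ.≤ M → ∣V∣ K ≡ ∣V∣ K' →
  (∀ s → ∣ s ∣ ≡ r → E K' s ≡ E K s) →
  (∀ e → InLayer K' r e → ∣Gq∣ K' q e ℕ.≤ ∣Gq∣ K q e) →
  (∀ e → InLayer K' r e → ∣Gq∣ K q e ℕ.≤ ∣Gq∣ K' q e + bad e) →
  (∀ e → InLayer K' r e → toℚ (bad e) ℚ.≤ toℚ C ℚ.* (ε ℚ.* toℚ (∣V∣ K' ^ (q ∸ r)))) →
  IsRegular ε d q r K → IsRegular (toℚ M ℚ.* ε) d q r K'
IsRegular-transfer K K' {ε} {d} {q} {r} C M bad 0≤ε C<M ∣V∣≡ sameLayer K'≤K K≤K'+bad bad≤ regular e e∈K' =
  lower , upper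
  where
  open ℚP.≤-Reasoning
  open ℚSolver.+-*-Solver
  W = toℚ (∣V∣ K' ^ (q ∸ r))
  regularK : ((d ℚ.- ε) ℚ.* W ℚ.≤ toℚ (∣Gq∣ K q e)) × (toℚ (∣Gq∣ K q e) ℚ.≤ (d ℚ.+ ε) ℚ.* W)
  regularK = subst (λ v → ((d ℚ.- ε) ℚ.* toℚ (v ^ (q ∸ r)) ℚ.≤ toℚ (∣Gq∣ K q e))
                          × (toℚ (∣Gq∣ K q e) ℚ.≤ (d ℚ.+ ε) ℚ.* toℚ (v ^ (q ∸ r))))
                   ∣V∣≡ (regular e (InLayer-transfer K K' sameLayer e e∈K'))
  lower : (d ℚ.- toℚ M ℚ.* ε) ℚ.* W ℚ.≤ toℚ (∣Gq∣ K' q e)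
  lower = begin
    (d ℚ.- toℚ M ℚ.* ε) ℚ.* W
      ≤⟨ *-monoʳ-≤-0≤ W (0≤toℚ (∣V∣ K' ^ (q ∸ r)))
           (ℚP.+-monoʳ-≤ d (ℚP.neg-antimono-≤ (*-monoʳ-≤-0≤ ε 0≤ε (toℚ-mono-≤ C<M)))) ⟩
    (d ℚ.- toℚ (suc C) ℚ.* ε) ℚ.* W
      ≡⟨ cong (λ x → (d ℚ.- x ℚ.* ε) ℚ.* W) (trans (toℚ-+ 1 C) (cong (ℚ._+ toℚ C) toℚ-1)) ⟩
    (d ℚ.- (1ℚ ℚ.+ toℚ C) ℚ.* ε) ℚ.* W
      ≡⟨ cong (ℚ._* W) (solve 3 (λ d c e → d :- (con 1ℚ :+ c) :* e := (d :- e) :- c :* e) refl d (toℚ C) ε) ⟩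
    ((d ℚ.- ε) ℚ.- toℚ C ℚ.* ε) ℚ.* W
      ≤⟨ ≤-minus-bounded (d ℚ.- ε) (toℚ C ℚ.* ε) W (proj₁ regularK) (toℚ-≤-+ (∣Gq∣ K' q e) (bad e) (K≤K'+bad e e∈K'))
           (ℚP.≤-trans (bad≤ e e∈K') (ℚP.≤-reflexive (sym (ℚP.*-assoc (toℚ C) ε W)))) ⟩
    toℚ (∣Gq∣ K' q e) ∎
  upper : toℚ (∣Gq∣ K' q e) ℚ.≤ (d ℚ.+ toℚ M ℚ.* ε) ℚ.* W
  upper = begin
    toℚ (∣Gq∣ K' q e)            ≤⟨ toℚ-mono-≤ (K'≤K e e∈K') ⟩
    toℚ (∣Gq∣ K q e)             ≤⟨ proj₂ regularK ⟩
    (d ℚ.+ ε) ℚ.* W              ≤⟨ *-monoʳ-≤-0≤ W (0≤toℚ (∣V∣ K' ^ (q ∸ r)))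
                                      (ℚP.+-monoʳ-≤ d (p≤toℚm*p M 0≤ε (ℕP.≤-trans (s≤s z≤n) C<M))) ⟩
    (d ℚ.+ toℚ M ℚ.* ε) ℚ.* W    ∎

IsDense-transfer : ∀ {N} (K K' : Cx N) {ξ ε q r} (S : ℕ) (bad : Subset N → ℕ) → ∣V∣ K ≡ ∣V∣ K' →
  (∀ s → ∣ s ∣ ≡ r → E K' s ≡ E K s) →
  (∀ e → InLayer K' r e → ∣Gq∣ K q e ℕ.≤ ∣Gq∣ K' q e + bad e) →
  (∀ e → InLayer K' r e → toℚ (bad e) ℚ.≤ toℚ S ℚ.* (ε ℚ.* toℚ (∣V∣ K' ^ (q ∸ r)))) →
  IsDense ξ q r K → IsDense (ξ ℚ.- toℚ S ℚ.* ε) q r K'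
IsDense-transfer K K' {ξ} {ε} {q} {r} S bad ∣V∣≡ sameLayer K≤K'+bad bad≤ dense e e∈K' =
  ≤-minus-bounded ξ (toℚ S ℚ.* ε) (toℚ (∣V∣ K' ^ (q ∸ r))) denseK (toℚ-≤-+ (∣Gq∣ K' q e) (bad e) (K≤K'+bad e e∈K'))
    (ℚP.≤-trans (bad≤ e e∈K') (ℚP.≤-reflexive (sym (ℚP.*-assoc (toℚ S) ε (toℚ (∣V∣ K' ^ (q ∸ r)))))))
  where
  denseK : ξ ℚ.* toℚ (∣V∣ K' ^ (q ∸ r)) ℚ.≤ toℚ (∣Gq∣ K q e)
  denseK = subst (λ v → ξ ℚ.* toℚ (v ^ (q ∸ r)) ℚ.≤ toℚ (∣Gq∣ K q e)) ∣V∣≡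
                 (dense e (InLayer-transfer K K' sameLayer e e∈K'))

extBool-cong : ∀ {N} (K K' : Cx N) r e Q → (∀ s → ∣ s ∣ ≡ r → E K' s ≡ E K s) → extBool K' r e Q ≡ extBool K r e Q
extBool-cong {N} K K' r e Q sameLayer = allᵇ-cong _ _ (allSubsets N) (λ s _ → pointwise s)
  where
  pointwise : ∀ s → (not ((∣ s ∣ ≡ᵇ r) ∧ (s ⊆ᵇ (Q ∪ e)) ∧ not (s =ᵇ e)) ∨ E K' s)
                  ≡ (not ((∣ s ∣ ≡ᵇ r) ∧ (s ⊆ᵇ (Q ∪ e)) ∧ not (s =ᵇ e)) ∨ E K s)
  pointwise s with ∣ s ∣ ≡ᵇ r in ∣s∣≡r
  ... | false = refl
  ... | true rewrite sameLayer s (≡ᵇ⇒≡ ∣ s ∣ r ∣s∣≡r) = refl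

∣ext∣-cong : ∀ {N} (K K' : Cx N) q r e → V K' ≡ V K → (∀ s → ∣ s ∣ ≡ r → E K' s ≡ E K s) →
             ∣ext∣ K' q r e ≡ ∣ext∣ K q r e
∣ext∣-cong K K' q r e V≡ sameLayer = count-cong _ _ λ Q →
  cong₂ (λ v x → (∣ Q ∣ ≡ᵇ (q ∸ r)) ∧ (Q ⊆ᵇ (v ─ e)) ∧ x) V≡ (extBool-cong K K' r e Q sameLayer)

IsExtendable-transfer : ∀ {N} (K K' : Cx N) {ξ ξ' q r} → ξ' ℚ.≤ ξ → V K' ≡ V K →
  (∀ s → ∣ s ∣ ≡ r → E K' s ≡ E K s) →
  IsExtendable ξ q r K → IsExtendable ξ' q r K'
IsExtendable-transfer K K' ξ'≤ξ V≡ sameLayer (inj₁ noEdges) =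
  inj₁ (λ e e∈K' → noEdges e (InLayer-transfer K K' sameLayer e e∈K'))
IsExtendable-transfer K K' {ξ} {ξ'} {q} {r} ξ'≤ξ V≡ sameLayer (inj₂ (X , X⊆V , bigX , extends)) =
  inj₂ (X , subst (X ⊆_) (sym V≡) X⊆V , bigX' , extends')
  where
  bigX' : ξ' ℚ.* toℚ (∣V∣ K') ℚ.≤ toℚ ∣ X ∣
  bigX' = ℚP.≤-trans (*-monoʳ-≤-0≤ (toℚ (∣V∣ K')) (0≤toℚ (∣V∣ K')) ξ'≤ξ)
            (subst (λ v → ξ ℚ.* toℚ ∣ v ∣ ℚ.≤ toℚ ∣ X ∣) (sym V≡) bigX)
  extends' : ∀ e → ∣ e ∣ ≡ r → e ⊆ X → ξ' ℚ.* toℚ (∣V∣ K' ^ (q ∸ r)) ℚ.≤ toℚ (∣ext∣ K' q r e)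
  extends' e ∣e∣≡r e⊆X = ℚP.≤-trans (*-monoʳ-≤-0≤ (toℚ (∣V∣ K' ^ (q ∸ r))) (0≤toℚ (∣V∣ K' ^ (q ∸ r))) ξ'≤ξ)
    (subst₂ (λ v x → ξ ℚ.* toℚ (∣ v ∣ ^ (q ∸ r)) ℚ.≤ toℚ x) (sym V≡) (sym (∣ext∣-cong K K' q r e V≡ sameLayer))
            (extends e ∣e∣≡r e⊆X))

module Removal {n : ℕ} (G : Cx n) (complex : IsComplex G) (q : ℕ) (Yused : Hypergraph n) where

  unusedEdge : Subset n → Bool
  unusedEdge s = E G s ∧ (∣ s ∣ ≡ᵇ q) ∧ not (Yused s)

  avoidsUsed : Subset n → Bool
  avoidsUsed x = allᵇ (λ s → not ((s ⊆ᵇ x) ∧ (∣ s ∣ ≡ᵇ q)) ∨ unusedEdge s) (allSubsets n)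

  remove-isComplex : IsComplex (remove q G Yused)
  remove-isComplex = (λ e e∈G' → proj₁ complex e (∧-elimˡ e∈G')) , closed
    where
    closed : ∀ e f → f ⊆ e → E (remove q G Yused) e ≡ true → E (remove q G Yused) f ≡ true
    closed e f f⊆e e∈G' = ∧-intro (proj₂ complex e f f⊆e (∧-elimˡ e∈G'))
      (allᵇ-intro _ (allSubsets n) λ s s∈ → weaken s (allᵇ-elim _ (allSubsets n) s (∧-elimʳ {E G e} e∈G') s∈))
      where
      weaken : ∀ s → (not ((s ⊆ᵇ e) ∧ (∣ s ∣ ≡ᵇ q)) ∨ unusedEdge s) ≡ true →
                     (not ((s ⊆ᵇ f) ∧ (∣ s ∣ ≡ᵇ q)) ∨ unusedEdge s) ≡ true
      weaken s with s ⊆ᵇ f in s⊆f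
      ... | false = λ _ → refl
      ... | true rewrite ⊆ᵇ-trans s f e s⊆f (⊆⇒⊆ᵇ f e f⊆e) = λ ok → ok

  avoidsUsed-small : ∀ x → ∣ x ∣ ℕ.< q → avoidsUsed x ≡ true
  avoidsUsed-small x x<q = allᵇ-intro _ (allSubsets n) (λ s _ → vacuous s)
    where
    vacuous : ∀ s → (not ((s ⊆ᵇ x) ∧ (∣ s ∣ ≡ᵇ q)) ∨ unusedEdge s) ≡ true
    vacuous s with s ⊆ᵇ x in s⊆x
    ... | false = refl
    ... | true rewrite ≢⇒≡ᵇ-false ∣ s ∣ q (λ ∣s∣≡q →
                 ℕP.<-irrefl refl (ℕP.≤-<-trans (subst (ℕ._≤ ∣ x ∣) ∣s∣≡q (⊆ᵇ⇒∣∣≤ s x s⊆x)) x<q)) = refl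

  ¬avoidsUsed⇒containsEdge : ∀ x → E G x ≡ true → avoidsUsed x ≡ false → containsEdge q Yused x ≡ true
  ¬avoidsUsed⇒containsEdge x x∈G fails with s , _ , s-fails ← allᵇ-false _ (allSubsets n) fails =
    anySubset-intro _ s (usedSubset s s-fails)
    where
    usedSubset : ∀ s → (not ((s ⊆ᵇ x) ∧ (∣ s ∣ ≡ᵇ q)) ∨ (E G s ∧ (∣ s ∣ ≡ᵇ q) ∧ not (Yused s))) ≡ false →
                 ((s ⊆ᵇ x) ∧ (∣ s ∣ ≡ᵇ q) ∧ Yused s) ≡ true
    usedSubset s with s ⊆ᵇ x in s⊆x
    ... | false = λ ()
    ... | true rewrite proj₂ complex x s (⊆ᵇ⇒⊆ s x s⊆x) x∈G with ∣ s ∣ ≡ᵇ q | Yused s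
    ...   | false | _     = λ ()
    ...   | true  | false = λ ()
    ...   | true  | true  = λ _ → refl

module LinkComparison {n : ℕ} (G : Cx n) (complex : IsComplex G) (q : ℕ) (Yused : Hypergraph n)
                      (F : List (Subset n)) (q₁ : ℕ) (Y : Hypergraph n) where
  open Removal G complex q Yused

  H : Cx n
  H = induced q₁ (linkAll G F) Y

  H' : Cx n
  H' = induced q₁ (linkAll (remove q G Yused) F) Y

  inducedByY : Subset n → Bool
  inducedByY g = allᵇ (λ s → not ((s ⊆ᵇ g) ∧ (∣ s ∣ ≡ᵇ q₁)) ∨ Y s) (allSubsets n)

  H'⊆H : ∀ g → E H' g ≡ true → E H g ≡ true
  H'⊆H g g∈H' = ∧-intro (∧-intro (∧-elimˡ g∈linkG') linksG) (∧-elimʳ {E (linkAll (remove q G Yused) F) g} g∈H')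
    where
    g∈linkG' = ∧-elimˡ g∈H'
    linksG : allᵇ (λ f → E G (f ∪ g)) F ≡ true
    linksG = allᵇ-intro _ F λ f f∈F → ∧-elimˡ (allᵇ-elim _ F f (∧-elimʳ {g ⊆ᵇ V H} g∈linkG') f∈F)

  H⊆H'∪hits : ∀ g → E H g ≡ true → E H' g ≡ false →
              Σ (Subset n) (λ f → (f ∈ F) × (containsEdge q Yused (f ∪ g) ≡ true))
  H⊆H'∪hits g g∈H g∉H' = witness (allᵇ-false _ F notAllG')
    where
    g∈linkG = ∧-elimˡ g∈H
    g⊆V = ∧-elimˡ g∈linkG
    linksG = ∧-elimʳ {g ⊆ᵇ V H} g∈linkG
    notAllG' : allᵇ (λ f → E G (f ∪ g) ∧ avoidsUsed (f ∪ g)) F ≡ false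
    notAllG' = ∧-falseʳ (∧-falseˡ g∉H' (∧-elimʳ {E (linkAll G F) g} g∈H)) g⊆V
    witness : Σ (Subset n) (λ f → (f ∈ F) × ((E G (f ∪ g) ∧ avoidsUsed (f ∪ g)) ≡ false)) →
              Σ (Subset n) (λ f → (f ∈ F) × (containsEdge q Yused (f ∪ g) ≡ true))
    witness (f , f∈F , f∪g∉G') =
      f , f∈F , ¬avoidsUsed⇒containsEdge (f ∪ g) f∪g∈G (∧-falseʳ f∪g∉G' f∪g∈G)
      where
      f∪g∈G = allᵇ-elim _ F f linksG f∈F

  H'≡H-small : ∀ g → (∀ f → f ∈ F → ∣ f ∪ g ∣ ℕ.< q) → E H' g ≡ E H g
  H'≡H-small g small = cong (λ z → ((g ⊆ᵇ V H) ∧ z) ∧ inducedByY g) (allᵇ-cong _ _ F λ f f∈F →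
    trans (cong (E G (f ∪ g) ∧_) (avoidsUsed-small (f ∪ g) (small f f∈F))) (BoolP.∧-identityʳ (E G (f ∪ g))))

  hitsUsed : ℕ → Subset n → Subset n → Bool
  hitsUsed a e h = (∣ h ∣ ≡ᵇ a) ∧ anyᵇ (λ f → containsEdge q Yused ((f ∪ e) ∪ h)) F

  ∣Gq∣-H'≤H : ∀ b e → ∣Gq∣ H' b e ℕ.≤ ∣Gq∣ H b e
  ∣Gq∣-H'≤H b e = count-mono-≤ _ _ λ h p →
    ∧³-replace (∣ h ∣ ≡ᵇ (b ∸ ∣ e ∣)) (h ⊆ᵇ V H) (∣ e ∪ h ∣ ≡ᵇ b) p (H'⊆H (e ∪ h))

  ∣Gq∣-H≤H'+hitsUsed : ∀ b e → ∣Gq∣ H b e ℕ.≤ ∣Gq∣ H' b e + count (hitsUsed (b ∸ ∣ e ∣) e)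
  ∣Gq∣-H≤H'+hitsUsed b e = count-≤-+ _ _ _ λ h p → split h p (E H' (e ∪ h)) refl
    where
    split : ∀ h → ((∣ h ∣ ≡ᵇ (b ∸ ∣ e ∣)) ∧ (h ⊆ᵇ V H) ∧ (∣ e ∪ h ∣ ≡ᵇ b) ∧ E H (e ∪ h)) ≡ true →
            ∀ x → E H' (e ∪ h) ≡ x →
            ((∣ h ∣ ≡ᵇ (b ∸ ∣ e ∣)) ∧ (h ⊆ᵇ V H) ∧ (∣ e ∪ h ∣ ≡ᵇ b) ∧ E H' (e ∪ h)) ≡ true
            ⊎ hitsUsed (b ∸ ∣ e ∣) e h ≡ true
    split h p true  e∪h∈H' = inj₁ (∧³-replace (∣ h ∣ ≡ᵇ (b ∸ ∣ e ∣)) (h ⊆ᵇ V H) (∣ e ∪ h ∣ ≡ᵇ b) p (λ _ → e∪h∈H'))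
    split h p false e∪h∉H'
      with f , f∈F , hit ← H⊆H'∪hits (e ∪ h) (∧³-last (∣ h ∣ ≡ᵇ (b ∸ ∣ e ∣)) (h ⊆ᵇ V H) (∣ e ∪ h ∣ ≡ᵇ b) p) e∪h∉H' =
      inj₂ (∧-intro (∧-elimˡ p)
             (anyᵇ-intro _ F f f∈F (subst (λ x → containsEdge q Yused x ≡ true) (sym (SubsetP.∪-assoc f e h)) hit)))

module RemovedLink {n : ℕ} (q r : ℕ) (ε : ℚ) (0≤ε : 0ℚ ℚ.≤ ε) (r<q : r ℕ.< q)
  (G : Cx n) (complex : IsComplex G) (Yused : Hypergraph n)
  (Yused-size : ∀ s → Yused s ≡ true → ∣ s ∣ ≡ q)
  (Δ : ∀ u → ∣ u ∣ ≡ r → toℚ (∣link∣ q Yused u) ℚ.≤ ε ℚ.* toℚ (n ^ (q ∸ r)))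
  (i : ℕ) (i≤r : i ℕ.≤ r) (F : List (Subset n)) (∣F∣≤2^i : length F ℕ.≤ 2 ^ i) (F-size : ∀ f → f ∈ F → ∣ f ∣ ≡ i)
  (n^≤2w^ : ∀ p → p ℕ.≤ q → n ^ p ℕ.≤ 2 * ∣ V (linkAll G F) ∣ ^ p)
  (Y : Hypergraph n) where

  r≤q : r ℕ.≤ q
  r≤q = ℕP.<⇒≤ r<q

  q₁ r₁ w : ℕ
  q₁ = q ∸ i
  r₁ = r ∸ i
  w = ∣ V (linkAll G F) ∣

  open LinkComparison G complex q Yused F q₁ Y
  open UsedEdgeCounts Yused q r ε 0≤ε r≤q Yused-size Δ

  ∣F∣≤2^r : length F ℕ.≤ 2 ^ r
  ∣F∣≤2^r = ℕP.≤-trans ∣F∣≤2^i (ℕP.^-monoʳ-≤ 2 i≤r)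

  ∣f∪e∣≤r : ∀ e → ∣ e ∣ ≡ r₁ → ∀ f → f ∈ F → ∣ f ∪ e ∣ ℕ.≤ r
  ∣f∪e∣≤r e ∣e∣≡r₁ f f∈F = ℕP.≤-trans (∣p∪q∣≤∣p∣+∣q∣ f e)
    (ℕP.≤-reflexive (trans (cong₂ _+_ (F-size f f∈F) ∣e∣≡r₁) (ℕP.m+[n∸m]≡n i≤r)))

  sameLayer : ∀ s → ∣ s ∣ ≡ r₁ → E H' s ≡ E H s
  sameLayer s ∣s∣≡r₁ = H'≡H-small s (λ f f∈F → ℕP.≤-<-trans (∣f∪e∣≤r s ∣s∣≡r₁ f f∈F) r<q)

  count-hitsUsed-≤-Δ : ∀ e → InLayer H' r₁ e →
    toℚ (count (hitsUsed (q₁ ∸ ∣ e ∣) e)) ℚ.≤ toℚ (2 ^ r * 2) ℚ.* (ε ℚ.* toℚ (w ^ (q₁ ∸ r₁)))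
  count-hitsUsed-≤-Δ e (∣e∣≡r₁ , _) = begin
    toℚ (count (hitsUsed (q₁ ∸ ∣ e ∣) e))
      ≤⟨ count-anyᵇ-≤ (λ h → ∣ h ∣ ≡ᵇ (q₁ ∸ ∣ e ∣)) (λ f h → containsEdge q Yused ((f ∪ e) ∪ h)) F
                       (ε ℚ.* toℚ (n ^ (q ∸ r))) perEdge ⟩
    toℚ (length F) ℚ.* (ε ℚ.* toℚ (n ^ (q ∸ r)))
      ≤⟨ toℚ-*-scale ε (length F) (2 ^ r) (n ^ (q ∸ r)) (w ^ (q₁ ∸ r₁)) 0≤ε ∣F∣≤2^r
           (subst (λ k → n ^ (q ∸ r) ℕ.≤ 2 * w ^ k) (sym q₁∸r₁≡q∸r) (n^≤2w^ (q ∸ r) (ℕP.m∸n≤m q r))) ⟩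
    toℚ (2 ^ r * 2) ℚ.* (ε ℚ.* toℚ (w ^ (q₁ ∸ r₁))) ∎
    where
    open ℚP.≤-Reasoning
    q₁∸r₁≡q∸r : q₁ ∸ r₁ ≡ q ∸ r
    q₁∸r₁≡q∸r = [m∸o]∸[n∸o]≡m∸n i≤r r≤q
    perEdge : ∀ f → f ∈ F →
      toℚ (count (λ h → (∣ h ∣ ≡ᵇ (q₁ ∸ ∣ e ∣)) ∧ containsEdge q Yused ((f ∪ e) ∪ h))) ℚ.≤ ε ℚ.* toℚ (n ^ (q ∸ r))
    perEdge f f∈F =
      subst (λ k → toℚ (count (λ h → (∣ h ∣ ≡ᵇ k) ∧ containsEdge q Yused ((f ∪ e) ∪ h))) ℚ.≤ ε ℚ.* toℚ (n ^ (q ∸ r)))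
            (sym (trans (cong (q₁ ∸_) ∣e∣≡r₁) q₁∸r₁≡q∸r))
            (count-containsEdge-≤-Δ (f ∪ e) (∣f∪e∣≤r e ∣e∣≡r₁ f f∈F))

  count-hitsUsed-≤ : ∀ e → InLayer H' r₁ e →
    toℚ (count (hitsUsed ((q₁ + r₁) ∸ ∣ e ∣) e)) ℚ.≤ toℚ (2 ^ (2 * r + 1)) ℚ.* (ε ℚ.* toℚ (w ^ ((q₁ + r₁) ∸ r₁)))
  count-hitsUsed-≤ e (∣e∣≡r₁ , _) = begin
    toℚ (count (hitsUsed ((q₁ + r₁) ∸ ∣ e ∣) e))
      ≤⟨ count-anyᵇ-≤ (λ h → ∣ h ∣ ≡ᵇ ((q₁ + r₁) ∸ ∣ e ∣)) (λ f h → containsEdge q Yused ((f ∪ e) ∪ h)) F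
                       (toℚ (2 ^ r) ℚ.* (ε ℚ.* toℚ (n ^ (q ∸ i)))) perEdge ⟩
    toℚ (length F) ℚ.* (toℚ (2 ^ r) ℚ.* (ε ℚ.* toℚ (n ^ (q ∸ i))))
      ≡⟨ sym (ℚP.*-assoc (toℚ (length F)) (toℚ (2 ^ r)) (ε ℚ.* toℚ (n ^ (q ∸ i)))) ⟩
    toℚ (length F) ℚ.* toℚ (2 ^ r) ℚ.* (ε ℚ.* toℚ (n ^ (q ∸ i)))
      ≡⟨ cong (ℚ._* (ε ℚ.* toℚ (n ^ (q ∸ i)))) (sym (toℚ-* (length F) (2 ^ r))) ⟩
    toℚ (length F * 2 ^ r) ℚ.* (ε ℚ.* toℚ (n ^ (q ∸ i)))
      ≤⟨ toℚ-*-scale ε (length F * 2 ^ r) (2 ^ r * 2 ^ r) (n ^ (q ∸ i)) (w ^ (q ∸ i)) 0≤ε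
           (ℕP.*-monoˡ-≤ (2 ^ r) ∣F∣≤2^r) (n^≤2w^ (q ∸ i) (ℕP.m∸n≤m q i)) ⟩
    toℚ (2 ^ r * 2 ^ r * 2) ℚ.* (ε ℚ.* toℚ (w ^ (q ∸ i)))
      ≡⟨ cong₂ (λ a k → toℚ a ℚ.* (ε ℚ.* toℚ (w ^ k))) (2^r*2^r*2≡2^[2r+1] r) (sym (ℕP.m+n∸n≡m q₁ r₁)) ⟩
    toℚ (2 ^ (2 * r + 1)) ℚ.* (ε ℚ.* toℚ (w ^ ((q₁ + r₁) ∸ r₁))) ∎
    where
    open ℚP.≤-Reasoning
    perEdge : ∀ f → f ∈ F →
      toℚ (count (λ h → (∣ h ∣ ≡ᵇ ((q₁ + r₁) ∸ ∣ e ∣)) ∧ containsEdge q Yused ((f ∪ e) ∪ h)))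
        ℚ.≤ toℚ (2 ^ r) ℚ.* (ε ℚ.* toℚ (n ^ (q ∸ i)))
    perEdge f f∈F =
      subst (λ k → toℚ (count (λ h → (∣ h ∣ ≡ᵇ k) ∧ containsEdge q Yused ((f ∪ e) ∪ h)))
                     ℚ.≤ toℚ (2 ^ r) ℚ.* (ε ℚ.* toℚ (n ^ (q ∸ i))))
            (sym (trans (cong ((q₁ + r₁) ∸_) ∣e∣≡r₁) (ℕP.m+n∸n≡m q₁ r₁)))
            (count-containsEdge-≤ (f ∪ e) i i≤r (∣f∪e∣≤r e ∣e∣≡r₁ f f∈F))

  remove-full : ∀ {ξ} → IsFullComplex ε ξ q₁ r₁ H →
                IsFullComplex (toℚ (2 ^ (r + 2)) ℚ.* ε) (ξ ℚ.- toℚ (2 ^ (2 * r + 1)) ℚ.* ε) q₁ r₁ H'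
  remove-full {ξ} ((d , ξ≤d , regular) , dense , extendable) =
      (d , ℚP.≤-trans ξ'≤ξ ξ≤d ,
       IsRegular-transfer H H' {ε} {d} {q₁} {r₁} (2 ^ r * 2) (2 ^ (r + 2)) (λ e → count (hitsUsed (q₁ ∸ ∣ e ∣) e)) 0≤ε
         (1+2^r*2≤2^[r+2] r) refl sameLayer (λ e _ → ∣Gq∣-H'≤H q₁ e) (λ e _ → ∣Gq∣-H≤H'+hitsUsed q₁ e)
         count-hitsUsed-≤-Δ regular)
    , IsDense-transfer H H' {ξ} {ε} {q₁ + r₁} {r₁} (2 ^ (2 * r + 1)) (λ e → count (hitsUsed ((q₁ + r₁) ∸ ∣ e ∣) e))
         refl sameLayer
         (λ e _ → ∣Gq∣-H≤H'+hitsUsed (q₁ + r₁) e) count-hitsUsed-≤ dense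
    , IsExtendable-transfer H H' {ξ} {ξ ℚ.- toℚ (2 ^ (2 * r + 1)) ℚ.* ε} {q₁} {r₁} ξ'≤ξ refl sameLayer extendable
    where
    ξ'≤ξ : ξ ℚ.- toℚ (2 ^ (2 * r + 1)) ℚ.* ε ℚ.≤ ξ
    ξ'≤ξ = begin
      ξ ℚ.- toℚ (2 ^ (2 * r + 1)) ℚ.* ε
        ≤⟨ ℚP.+-monoʳ-≤ ξ (ℚP.neg-antimono-≤ (0≤* (0≤toℚ (2 ^ (2 * r + 1))) 0≤ε)) ⟩
      ξ ℚ.- 0ℚ
        ≡⟨ solve 1 (λ x → x :- con 0ℚ := x) refl ξ ⟩
      ξ ∎
      where
      open ℚP.≤-Reasoning
      open ℚSolver.+-*-Solver

remove-isSupercomplex : ∀ {n} q r {ε ξ} → 0ℚ ℚ.≤ ε → r ℕ.< q → (G : Cx n) (Yused : Hypergraph n) →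
  (∀ s → Yused s ≡ true → ∣ s ∣ ≡ q) →
  (∀ u → ∣ u ∣ ≡ r → toℚ (∣link∣ q Yused u) ℚ.≤ ε ℚ.* toℚ (n ^ (q ∸ r))) →
  (∀ i → i ℕ.≤ r → (F : List (Subset n)) → length F ℕ.≤ 2 ^ i → (∀ f → f ∈ F → ∣ f ∣ ≡ i) →
     ∀ p → p ℕ.≤ q → n ^ p ℕ.≤ 2 * ∣ V (linkAll G F) ∣ ^ p) →
  IsSupercomplex ε ξ q r G →
  IsSupercomplex (toℚ (2 ^ (r + 2)) ℚ.* ε) (ξ ℚ.- toℚ (2 ^ (2 * r + 1)) ℚ.* ε) q r (remove q G Yused)
remove-isSupercomplex {n} q r {ε} {ξ} 0≤ε r<q G Yused Yused-size Δ n^≤2w^ (complex , links) =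
  Removal.remove-isComplex G complex q Yused , links'
  where
  links' : ∀ i → i ℕ.≤ r → (F : List (Subset n)) → Unique F → 1 ℕ.≤ length F → length F ℕ.≤ 2 ^ i →
           (∀ f → f ∈ F → InLayer (remove q G Yused) i f) →
           IsEpsComplex (toℚ (2 ^ (r + 2)) ℚ.* ε) (ξ ℚ.- toℚ (2 ^ (2 * r + 1)) ℚ.* ε) (q ∸ i) (r ∸ i)
                        (linkAll (remove q G Yused) F)
  links' i i≤r F unique nonempty ∣F∣≤2^i F⊆G' =
    removeFrom (links i i≤r F unique nonempty ∣F∣≤2^i λ f f∈F → F-size f f∈F , ∧-elimˡ (proj₂ (F⊆G' f f∈F)))
    where
    F-size : ∀ f → f ∈ F → ∣ f ∣ ≡ i
    F-size f f∈F = proj₁ (F⊆G' f f∈F)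
    removeFrom : IsEpsComplex ε ξ (q ∸ i) (r ∸ i) (linkAll G F) →
                 IsEpsComplex (toℚ (2 ^ (r + 2)) ℚ.* ε) (ξ ℚ.- toℚ (2 ^ (2 * r + 1)) ℚ.* ε) (q ∸ i) (r ∸ i)
                              (linkAll (remove q G Yused) F)
    removeFrom (Y , Y-graph , full) = Y , Y-graph ,
      RemovedLink.remove-full q r ε 0≤ε r<q G complex Yused Yused-size Δ i i≤r F ∣F∣≤2^i F-size
                              (n^≤2w^ i i≤r F ∣F∣≤2^i F-size) Y full

n^p≤2*∣V-linkAll∣^p : ∀ {n} q r (G : Cx n) → V G ≡ ⊤ → 2 * q * (2 ^ r * r) + 2 ^ r * r + 1 ℕ.≤ n →
  ∀ i → i ℕ.≤ r → (F : List (Subset n)) → length F ℕ.≤ 2 ^ i → (∀ f → f ∈ F → ∣ f ∣ ≡ i) →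
  ∀ p → p ℕ.≤ q → n ^ p ℕ.≤ 2 * ∣ V (linkAll G F) ∣ ^ p
n^p≤2*∣V-linkAll∣^p {n} q r G V≡⊤ n₀≤n i i≤r F ∣F∣≤2^i sizes p p≤q =
  ℕP.≤-trans (ℕP.^-monoˡ-≤ p n≤w+C) ([m+c]^p≤2*m^p w C p 1≤w 2pC≤w)
  where
  open ℕP.≤-Reasoning
  C = 2 ^ r * r
  w = ∣ V (linkAll G F) ∣
  n≤w+C : n ℕ.≤ w + C
  n≤w+C = begin
    n                    ≡⟨ sym (trans (cong ∣_∣ V≡⊤) (SubsetP.∣⊤∣≡n n)) ⟩
    ∣ V G ∣              ≤⟨ ∣U∣≤∣U─F∣+∣F∣*i (V G) F i sizes ⟩
    w + length F * i     ≤⟨ ℕP.+-monoʳ-≤ w (ℕP.*-mono-≤ (ℕP.≤-trans ∣F∣≤2^i (ℕP.^-monoʳ-≤ 2 i≤r)) i≤r) ⟩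
    w + C                ∎
  2qC+1≤w : 2 * q * C + 1 ℕ.≤ w
  2qC+1≤w = ℕP.+-cancelʳ-≤ C (2 * q * C + 1) w (begin
    2 * q * C + 1 + C    ≡⟨ solve 2 (λ a c → a :+ con 1 :+ c := a :+ c :+ con 1) refl (2 * q * C) C ⟩
    2 * q * C + C + 1    ≤⟨ n₀≤n ⟩
    n                    ≤⟨ n≤w+C ⟩
    w + C                ∎)
    where open +-*-Solver
  1≤w : 1 ℕ.≤ w
  1≤w = ℕP.≤-trans (ℕP.m≤n+m 1 (2 * q * C)) 2qC+1≤w
  2pC≤w : 2 * p * C ℕ.≤ w
  2pC≤w = ℕP.≤-trans (ℕP.*-monoˡ-≤ C (ℕP.*-monoʳ-≤ 2 p≤q)) (ℕP.≤-trans (ℕP.m≤m+n (2 * q * C) 1) 2qC+1≤w)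

proposition3p12 :
  (q r : ℕ) → 1 ≤ r → r < q →
  (ε ξ : ℚ) → 0ℚ <ℚ ε → ε ≤ℚ 1ℚ → 0ℚ <ℚ ξ → ξ ≤ℚ 1ℚ →
  Σ ℕ (λ n₀ → (n : ℕ) → n₀ ≤ n →
    (G : Cx n) → V G ≡ ⊤ → IsSupercomplex ε ξ q r G →
    (Yused : Hypergraph n) → IsGraphOn q (V G) Yused →
    Δ≤ q r (V G) Yused (ε *ℚ toℚ (n ^ (q ∸ r))) →
    IsSupercomplex (toℚ (2 ^ (r + 2)) *ℚ ε)
                   (ξ - toℚ (2 ^ (2 * r + 1)) *ℚ ε)
                   q r (remove q G Yused))
proposition3p12 q r _ r<q ε ξ 0<ε _ _ _ =
  2 * q * (2 ^ r * r) + 2 ^ r * r + 1 , λ n n₀≤n G V≡⊤ supercomplex Yused Yused-graph Δ →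
    remove-isSupercomplex q r (ℚP.<⇒≤ 0<ε) r<q G Yused (λ s s∈Y → proj₁ (Yused-graph s s∈Y))
      (λ u ∣u∣≡r → Δ u ∣u∣≡r (subst (u ⊆_) (sym V≡⊤) SubsetP.⊆⊤))
      (n^p≤2*∣V-linkAll∣^p q r G V≡⊤ n₀≤n) supercomplex
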